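{- $\frac{n^2}{8}-O(n)\le h_A(n)\le \frac{n^2}{4}+O(n)$.
   Context: A tree $T$ is hidden on a known vertex set $V$ with $|V|=n$. A distance query is an unordered pair $\{x,y\}$ of distinct vertices, answered by the distance $d_T(x,y)$ in $T$. In an adaptive algorithm each query may depend on previous answers. A tree on $V$ is consistent with the answers if its distances agree with all answers received. $h_A(n)$ is the smallest $k$ such that there is an adaptive algorithm which, for every hidden tree $T$ on $V$, after at most $k$ queries reaches a state in which all trees on $V$ consistent with the answers are isomorphic to each other. -}

module Defs where

open import Data.Nat using (ℕ; zero; suc; _+_; _*_; _≤_; _≥_)
open import Data.Fin using (Fin)
open import Data.Fin.Permutation using (Permutation′; _⟨$⟩ʳ_)
open import Data.Bool using (Bool; true; false)
open import Data.List using (List; []; _∷_; length)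
open import Data.List.Relation.Unary.All using (All)
open import Data.List.Relation.Unary.Unique.Propositional using (Unique)
open import Data.List.Relation.Unary.Linked using (Linked)
open import Data.List.NonEmpty using (List⁺; _∷_; toList; head; last)
open import Data.Product using (Σ; _×_; _,_; ∃)
open import Data.Empty using (⊥)
open import Relation.Binary.PropositionalEquality using (_≡_; _≢_)

record Graph (n : ℕ) : Set where
  field
    adj   : Fin n → Fin n → Bool
    sym   : ∀ x y → adj x y ≡ adj y x
    irrefl : ∀ x → adj x x ≡ false

open Graph public

Adj : ∀ {n} → Graph n → Fin n → Fin n → Set
Adj G x y = adj G x y ≡ true

data Walk {n : ℕ} (G : Graph n) : Fin n → Fin n → ℕ → Set where
  here  : ∀ {x} → Walk G x x 0
  step  : ∀ {x y z m} → Adj G x y → Walk G y z m → Walk G x z (suc m)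

Connected : ∀ {n} → Graph n → Set
Connected G = ∀ x y → ∃ λ m → Walk G x y m

record Cycle {n : ℕ} (G : Graph n) : Set where
  field
    verts    : List⁺ (Fin n)
    long     : 3 ≤ length (toList verts)
    distinct : Unique (toList verts)
    linked   : Linked (Adj G) (toList verts)
    closing  : Adj G (last verts) (head verts)

Acyclic : ∀ {n} → Graph n → Set
Acyclic G = Cycle G → ⊥

record Tree (n : ℕ) : Set where
  field
    graph     : Graph n
    connected : Connected graph
    acyclic   : Acyclic graph

open Tree public

Dist : ∀ {n} → Tree n → Fin n → Fin n → ℕ → Set
Dist T x y d = Walk (graph T) x y d × (∀ m → Walk (graph T) x y m → d ≤ m)

Isomorphic : ∀ {n} → Tree n → Tree n → Set
Isomorphic {n} T₁ T₂ =
  Σ (Permutation′ n) λ π → ∀ x y → adj (graph T₁) x y ≡ adj (graph T₂) (π ⟨$⟩ʳ x) (π ⟨$⟩ʳ y)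

-- Adaptive query algorithms (decision trees)

data Alg (n : ℕ) : Set where
  done : Alg n
  ask  : (x y : Fin n) → x ≢ y → (ℕ → Alg n) → Alg n

record Answer (n : ℕ) : Set where
  constructor ans
  field
    qx qy : Fin n
    qd    : ℕ

Consistent : ∀ {n} → Tree n → List (Answer n) → Set
Consistent T hist = All (λ a → Dist T (Answer.qx a) (Answer.qy a) (Answer.qd a)) hist

Determined : ∀ {n} → List (Answer n) → Set
Determined {n} hist =
  (T₁ T₂ : Tree n) → Consistent T₁ hist → Consistent T₂ hist → Isomorphic T₁ T₂

Works : ∀ {n} → Tree n → Alg n → List (Answer n) → ℕ → Set
Works T done hist k = Determined hist
Works T (ask x y _ f) hist zero = ⊥
Works T (ask x y _ f) hist (suc k) =
  ∀ d → Dist T x y d → Works T (f d) (ans x y d ∷ hist) k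

-- There is an adaptive algorithm that succeeds with at most k queries
-- on every hidden tree; h_A(n) is the least such k.
Solves : ℕ → ℕ → Set
Solves n k = Σ (Alg n) λ A → (T : Tree n) → Works T A [] k

{-# OPTIONS --safe #-}
-- Upper bound: ask every vertex for its distance to a root.  Adjacent vertices
-- of a tree have depths of different parity, so asking the at most n²/4 pairs
-- of opposite depth parity reveals every edge.
--
-- Lower bound: write n = 1 + 2m + r with r ≤ 1, and for f : Fin m → Fin m let
-- spider f have a centre joined to m inner vertices (and r extra leaves), the
-- outer vertex j hanging below the inner vertex f j.  For a permutation f the
-- tree has no cherry (two leaves with a common neighbour); for a non-injective
-- f it has one.  An adversary keeps a permutation σ and answers consistently
-- with every f keeping its promises.  Let U be the set of outer vertices it has
-- not committed, and weigh each ordered pair (x, y) in U by the promises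
-- f x ≢ f y (1 each way) and f x ≢ σ y (2).  Each query raises the total
-- weight Ψ by at most 2, or commits one j ∈ U and lowers Ψ by at least
-- 2 |U \ {j}|; so |U|² ≤ 2k + Ψ + |U| holds while k queries remain.  When the
-- algorithm stops every pair in U has positive weight, since otherwise sending
-- f x to σ y keeps all answers true and creates a cherry; so |U|² ≤ Ψ + |U|.
-- Starting from U = all m outer vertices and Ψ = 0 this gives m² ≤ 2k + m,
-- i.e. n² ≤ 8k + O(n).
module Submission where

open import Defs hiding (sym)

open import Data.Bool as Bool using (Bool; true; false; _∨_; _∧_; not)
open import Data.Bool.Properties using () renaming (∨-zeroʳ to ∨-zeroʳ-Bool; ∧-zeroʳ to ∧-zeroʳ-Bool)
open import Data.Empty using (⊥; ⊥-elim)
open import Data.Fin using (Fin; zero; suc; _≟_; join; splitAt)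
open import Data.Fin.Permutation as Perm using (Permutation′; _⟨$⟩ʳ_; _⟨$⟩ˡ_; _∘ₚ_)
open import Data.Fin.Properties using (splitAt-join; join-splitAt; any?)
open import Data.List as List using (List; []; _∷_; _++_; [_]; length)
open import Data.List.Membership.Propositional using (_∈_)
open import Data.List.Membership.Propositional.Properties
  using (∈-allFin; ∈-map⁺; ∈-filter⁺; ∈-cartesianProduct⁺)
open import Data.List.NonEmpty using (_∷_; last)
open import Data.List.Properties using (length-map; length-++; length-tabulate)
open import Data.List.Relation.Binary.Subset.Propositional using (_⊆_)
open import Data.List.Relation.Unary.All as All using (All; []; _∷_)
open import Data.List.Relation.Unary.All.Properties using (∷ʳ⁺; All¬⇒¬Any)
open import Data.List.Relation.Unary.AllPairs using ([]; _∷_)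
open import Data.List.Relation.Unary.Any using (here; there)
open import Data.List.Relation.Unary.Linked using (Linked; [-]; _∷_)
open import Data.List.Relation.Unary.Unique.Propositional using (Unique)
open import Data.Nat using (ℕ; zero; suc; _+_; _*_; _≤_; _<_; z≤n; s≤s; parity; _≡ᵇ_)
open import Data.Nat.DivMod using (_/_; m/n*n≤m; m*n/n≡m; /-monoˡ-≤)
open import Data.Nat.Properties
  using (≤-refl; ≤-reflexive; ≤-trans; ≤-antisym; ≤-total; ≤-pred; <-trans; <-asym; n≮n; ≮⇒≥;
         ≡ᵇ⇒≡; n≤1+n; m≤m+n; m≤n+m; m≤n⇒∃[o]m+o≡n; +-suc; +-comm; +-assoc; +-identityʳ;
         *-comm; *-identityʳ; *-zeroʳ; *-distribˡ-+; *-distribʳ-+; +-mono-≤; +-monoˡ-≤; +-monoʳ-≤;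
         *-mono-≤; *-monoˡ-≤; *-monoʳ-≤; module ≤-Reasoning)
open import Data.Nat.Tactic.RingSolver using (solve-∀)
open import Algebra.Properties.Semiring.Sum Data.Nat.Properties.+-*-semiring
  using (sum-syntax; sum-cong-≗; ∑-distrib-+; ∑-permute; sum-replicate-zero;
         *-distribˡ-sum; *-distribʳ-sum)
open import Data.Parity using (Parity; 0ℙ; 1ℙ; _⁻¹)
import Data.Parity.Properties as Parity
open import Data.Product using (Σ; _×_; _,_; ∃; proj₁; proj₂)
open import Data.Sum using (_⊎_; inj₁; inj₂)
open import Function using (_∘_; case_of_)
open import Function.Bundles using (mk⇔)
open import Relation.Binary.PropositionalEquality
  using (_≡_; _≢_; refl; sym; trans; cong; cong₂; subst; subst₂; ≢-sym; module ≡-Reasoning)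
open import Relation.Nullary using (¬_; Dec; yes; no; does)
open import Relation.Nullary.Decidable using (dec-true; dec-false; does-⇔; _×-dec_; ¬?)

does⇒witness : {A : Set} (a? : Dec A) → does a? ≡ true → A
does⇒witness (yes a) _ = a

final : {A : Set} → A → List A → A
final x []       = x
final x (y ∷ ys) = final y ys

last≡final : {A : Set} (x : A) (xs : List A) → last (x ∷ xs) ≡ final x xs
last≡final x []       = refl
last≡final x (y ∷ ys) with List.initLast ys | last≡final y ys
... | List.[]        | eq = eq
... | _ List.∷ʳ′ _   | eq = eq

final-∷ʳ : {A : Set} (x : A) (xs : List A) (z : A) → final x (xs ++ [ z ]) ≡ z
final-∷ʳ x []       z = refl
final-∷ʳ x (y ∷ ys) z = final-∷ʳ y ys z

Linked-∷ʳ : {A : Set} {R : A → A → Set} {x z : A} (xs : List A) →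
  Linked R (x ∷ xs) → R (final x xs) z → Linked R (x ∷ xs ++ [ z ])
Linked-∷ʳ []       _          r = r ∷ [-]
Linked-∷ʳ (y ∷ ys) (r′ ∷ rs) r = r′ ∷ Linked-∷ʳ ys rs r

Unique-∷ʳ : {A : Set} (xs : List A) {z : A} → Unique xs → All (_≢ z) xs → Unique (xs ++ [ z ])
Unique-∷ʳ []       _        _        = [] ∷ []
Unique-∷ʳ (x ∷ xs) (x∉ ∷ u) (x≢ ∷ ≢s) = ∷ʳ⁺ x∉ x≢ ∷ Unique-∷ʳ xs u ≢s

clash : ∀ {b} → b ≡ true → b ≡ false → ⊥
clash refl ()

≡-by-parity : ∀ a b → a ≤ suc b → b ≤ suc a → parity a ≡ parity b → a ≡ b
≡-by-parity zero          zero          _       _       _ = refl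
≡-by-parity zero          (suc zero)    _       _       ()
≡-by-parity zero          (suc (suc _)) _       (s≤s ()) _
≡-by-parity (suc zero)    zero          _       _       ()
≡-by-parity (suc (suc _)) zero          (s≤s ()) _      _
≡-by-parity (suc a)       (suc b)       (s≤s p) (s≤s q) e =
  cong suc (≡-by-parity a b p q (begin
    parity a                ≡⟨ Parity.suc-homo-⁻¹ a ⟨
    parity (suc a) ⁻¹       ≡⟨ cong _⁻¹ e ⟩
    parity (suc b) ⁻¹       ≡⟨ Parity.suc-homo-⁻¹ b ⟩
    parity b                ∎))
  where open ≡-Reasoning

module _ {n : ℕ} (G : Graph n) where

  Adj-sym : ∀ {x y} → Adj G x y → Adj G y x
  Adj-sym {x} {y} e = trans (Graph.sym G y x) e

  Adj⇒≢ : ∀ {x y} → Adj G x y → x ≢ y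
  Adj⇒≢ {x} e refl with () ← trans (sym e) (irrefl G x)

  walk-snoc : ∀ {x y z a} → Walk G x y a → Adj G y z → Walk G x z (suc a)
  walk-snoc here       e = step e here
  walk-snoc (step e′ w) e = step e′ (walk-snoc w e)

  walk-reverse : ∀ {x y a} → Walk G x y a → Walk G y x a
  walk-reverse here       = here
  walk-reverse (step e w) = walk-snoc (walk-reverse w) (Adj-sym e)

  walk-append : ∀ {x y z a b} → Walk G x y a → Walk G y z b → Walk G x z (a + b)
  walk-append here       w′ = w′
  walk-append (step e w) w′ = step e (walk-append w w′)

module _ {n : ℕ} (T : Tree n) where
  private
    G = graph T

  Dist-sym : ∀ {x y d} → Dist T x y d → Dist T y x d
  Dist-sym (w , min) = walk-reverse G w , λ m w′ → min m (walk-reverse G w′)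

  Dist-functional : ∀ {x y d d′} → Dist T x y d → Dist T x y d′ → d ≡ d′
  Dist-functional (w , min) (w′ , min′) = ≤-antisym (min _ w′) (min′ _ w)

  Dist-intro : ∀ {x y d} → Walk G x y d → (∀ ℓ → ℓ < d → ¬ Walk G x y ℓ) → Dist T x y d
  Dist-intro w shorter = w , λ ℓ w′ → ≮⇒≥ (λ ℓ<d → shorter ℓ ℓ<d w′)

  Dist-1⇒Adj : ∀ {x y} → Dist T x y 1 → Adj G x y
  Dist-1⇒Adj (step e here , _) = e

  Adj⇒Dist-1 : ∀ {x y} → Adj G x y → Dist T x y 1
  Adj⇒Dist-1 e = Dist-intro (step e here) λ { zero _ here → Adj⇒≢ G e refl ; (suc _) (s≤s ()) _ }

  private
    Far : Fin n → ℕ → Fin n → Set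
    Far r k v = ∀ ℓ → Walk G v r ℓ → k ≤ ℓ

    near≢far : ∀ {r k v u} → Walk G v r k → Far r (suc k) u → v ≢ u
    near≢far {k = k} w far refl = n≮n k (far k w)

    -- Walking down two geodesics to r in parallel, the path x ⋯ y grows at
    -- both ends until the two geodesics meet and close a cycle.
    grow : ∀ {r k x y} → Walk G x r k → Walk G y r k → (M : List (Fin n)) →
      x ≢ y → final x M ≡ y → Linked (Adj G) (x ∷ M) → Unique (x ∷ M) →
      All (Far r k) (x ∷ M) → ⊥
    grow here here _ x≢y _ _ _ _ = x≢y refl
    grow {r} {suc k} {x} {y} (step {y = x′} ex wx) (step {y = y′} ey wy) M x≢y fin path uniq far
      with x′ ≟ y′
    ... | yes refl = acyclic T record
      { verts    = x′ ∷ x ∷ M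
      ; long     = long M fin
      ; distinct = All.map (near≢far wx) far ∷ uniq
      ; linked   = Adj-sym G ex ∷ path
      ; closing  = subst (λ v → Adj G v x′) (sym (trans (last≡final x′ (x ∷ M)) fin)) ey
      }
      where
      long : ∀ M → final x M ≡ y → 3 ≤ length (x′ ∷ x ∷ M)
      long []      x≡y = ⊥-elim (x≢y x≡y)
      long (_ ∷ _) _   = s≤s (s≤s (s≤s z≤n))
    ... | no x′≢y′ =
      grow wx wy (x ∷ M ++ [ y′ ]) x′≢y′ (final-∷ʳ x M y′)
        (Adj-sym G ex ∷ Linked-∷ʳ M path (subst (λ v → Adj G v y′) (sym fin) ey))
        (∷ʳ⁺ (All.map (near≢far wx) far) x′≢y′
          ∷ Unique-∷ʳ (x ∷ M) uniq (All.map (λ f → ≢-sym (near≢far wy f)) far))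
        (far-after ex (All.head far) ∷ ∷ʳ⁺ (All.map weaken far) (far-after ey far-y))
      where
      far-after : ∀ {v v′} → Adj G v v′ → Far r (suc k) v → Far r k v′
      far-after e far-v ℓ w = ≤-pred (far-v (suc ℓ) (step e w))
      weaken : ∀ {v} → Far r (suc k) v → Far r k v
      weaken far-v ℓ w = ≤-trans (n≤1+n k) (far-v ℓ w)
      far-final : ∀ z Z → All (Far r (suc k)) (z ∷ Z) → Far r (suc k) (final z Z)
      far-final z []       (p ∷ _)  = p
      far-final z (z′ ∷ Z) (_ ∷ ps) = far-final z′ Z ps
      far-y : Far r (suc k) y
      far-y = subst (Far r (suc k)) fin (far-final x M far)

  equidistant⇒¬Adj : ∀ {r x y k} → Dist T x r k → Dist T y r k → ¬ Adj G x y
  equidistant⇒¬Adj (wx , min-x) (wy , min-y) e =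
    grow wx wy [ _ ] (Adj⇒≢ G e) refl (e ∷ [-])
      ((Adj⇒≢ G e ∷ []) ∷ [] ∷ []) (min-x ∷ min-y ∷ [])

  Dist⇒adj : ∀ {x y d} → Dist T x y d → adj G x y ≡ (d ≡ᵇ 1)
  Dist⇒adj {x} {y} {d} dist with adj G x y in e | d ≡ᵇ 1 in d≡1
  ... | true  | true  = refl
  ... | false | false = refl
  ... | true  | false with refl ← Dist-functional (Adj⇒Dist-1 e) dist with () ← d≡1
  ... | false | true  with refl ← ≡ᵇ⇒≡ d 1 (subst Bool.T (sym d≡1) _)
                      with () ← trans (sym e) (Dist-1⇒Adj dist)

  parity≡⇒adj≡false : ∀ {r x y a b} → Dist T x r a → Dist T y r b → parity a ≡ parity b →
    adj G x y ≡ false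
  parity≡⇒adj≡false {r} {x} {y} {a} {b} dx@(wx , min-x) dy@(wy , min-y) pa≡pb with adj G x y in e
  ... | false = refl
  ... | true  = ⊥-elim (equidistant⇒¬Adj dx (subst (Dist T y r) (sym a≡b) dy) e)
    where
    a≡b : a ≡ b
    a≡b = ≡-by-parity a b (min-x _ (step e wy)) (min-y _ (step (Adj-sym G e) wx)) pa≡pb

  record PendantAt (u p : Fin n) : Set where
    constructor pendantAt
    field
      adjacent : Adj G u p
      only     : ∀ w → Adj G u w → w ≡ p

  Cherry : Set
  Cherry = Σ (Fin n) λ l₁ → Σ (Fin n) λ l₂ → Σ (Fin n) λ v →
    l₁ ≢ l₂ × PendantAt l₁ v × PendantAt l₂ v

  PendantAt-functional : ∀ {u p q} → PendantAt u p → PendantAt u q → p ≡ q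
  PendantAt-functional (pendantAt e _) (pendantAt _ only) = only _ e

  two-neighbours⇒¬PendantAt : ∀ {u w₁ w₂ p} → Adj G u w₁ → Adj G u w₂ → w₁ ≢ w₂ →
    ¬ PendantAt u p
  two-neighbours⇒¬PendantAt e₁ e₂ w₁≢w₂ (pendantAt _ only) =
    w₁≢w₂ (trans (only _ e₁) (sym (only _ e₂)))

  Dist-PendantAt : ∀ {u p v d} → PendantAt u p → u ≢ v → Dist T p v d → Dist T u v (suc d)
  Dist-PendantAt {u} {p} {v} {d} (pendantAt e only) u≢v (w , min) = step e w , min′
    where
    min′ : ∀ ℓ → Walk G u v ℓ → suc d ≤ ℓ
    min′ zero    here                  = ⊥-elim (u≢v refl)
    min′ (suc ℓ) (step {y = w₁} e₁ w′) =
      s≤s (min ℓ (subst (λ x → Walk G x v ℓ) (only w₁ e₁) w′))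

  Dist-2 : ∀ {x y} z → x ≢ y → ¬ Adj G x y → Adj G x z → Adj G z y → Dist T x y 2
  Dist-2 _ x≢y ¬xy e₁ e₂ = Dist-intro (step e₁ (step e₂ here)) λ
    { zero          _              here          → x≢y refl
    ; (suc zero)    _              (step e here) → ¬xy e
    ; (suc (suc _)) (s≤s (s≤s ())) _ }

-- A vertex has only one parent, so along a path, once an edge leads from a
-- parent to its child all later edges do too, and the ranks keep growing.
module _ {n : ℕ} (G : Graph n) (parent : Fin n → Fin n) (rank : Fin n → ℕ)
         (edge⇒parent : ∀ {x y} → Adj G x y → x ≡ parent y ⊎ y ≡ parent x)
         (rank-parent : ∀ {x y} → Adj G x y → x ≡ parent y → rank x < rank y) where

  private
    penultimate : Fin n → Fin n → List (Fin n) → Fin n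
    penultimate x y []       = x
    penultimate x y (z ∷ zs) = penultimate y z zs

    penultimate-∈ : ∀ x y zs → penultimate x y zs ∈ x ∷ y ∷ zs
    penultimate-∈ x y []       = here refl
    penultimate-∈ x y (z ∷ zs) = there (penultimate-∈ y z zs)

    final-∈ : ∀ (x : Fin n) zs → final x zs ∈ x ∷ zs
    final-∈ x []       = here refl
    final-∈ x (z ∷ zs) = there (final-∈ z zs)

    no-two-parents : ∀ {x y z zs} → Unique (x ∷ y ∷ z ∷ zs) → x ≡ parent y → z ≡ parent y → ⊥
    no-two-parents ((_ ∷ x≢z ∷ _) ∷ _) x≡py z≡py = x≢z (trans x≡py (sym z≡py))

    descending : ∀ x y zs → Linked (Adj G) (x ∷ y ∷ zs) → Unique (x ∷ y ∷ zs) → x ≡ parent y →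
      penultimate x y zs ≡ parent (final y zs) × rank x < rank (final y zs)
    descending x y []       (e ∷ _) _ x≡py = x≡py , rank-parent e x≡py
    descending x y (z ∷ zs) (e ∷ path@(e′ ∷ _)) u@(_ ∷ u′) x≡py with edge⇒parent e′
    ... | inj₁ y≡pz = let pen , x<fin = descending y z zs path u′ y≡pz in
                      pen , <-trans (rank-parent e x≡py) x<fin
    ... | inj₂ z≡py = ⊥-elim (no-two-parents u x≡py z≡py)

    ascending : ∀ x y zs → Linked (Adj G) (x ∷ y ∷ zs) → Unique (x ∷ y ∷ zs) →
      penultimate x y zs ≢ parent (final y zs) → rank (final y zs) < rank x
    ascending x y [] (e ∷ _) _ pen≢ with edge⇒parent e
    ... | inj₁ x≡py = ⊥-elim (pen≢ x≡py)
    ... | inj₂ y≡px = rank-parent (Adj-sym G e) y≡px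
    ascending x y (z ∷ zs) (e ∷ path@(e′ ∷ _)) u@(_ ∷ u′) pen≢ with edge⇒parent e
    ... | inj₂ y≡px = <-trans (ascending y z zs path u′ pen≢) (rank-parent (Adj-sym G e) y≡px)
    ... | inj₁ x≡py with edge⇒parent e′
    ...   | inj₁ y≡pz = ⊥-elim (pen≢ (proj₁ (descending y z zs path u′ y≡pz)))
    ...   | inj₂ z≡py = ⊥-elim (no-two-parents u x≡py z≡py)

    closed-path : ∀ x y z zs → Unique (x ∷ y ∷ z ∷ zs) → Linked (Adj G) (x ∷ y ∷ z ∷ zs) →
      Adj G (final z zs) x → ⊥
    closed-path x y z zs u@(x∉ ∷ y∉ ∷ _) path@(e ∷ _) closing
      with edge⇒parent e | edge⇒parent closing
    ... | inj₁ x≡py | inj₁ fin≡px =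
      <-asym (proj₂ (descending x y (z ∷ zs) path u x≡py)) (rank-parent closing fin≡px)
    ... | inj₁ x≡py | inj₂ x≡pfin = All¬⇒¬Any x∉ (subst (_∈ y ∷ z ∷ zs)
      (trans (proj₁ (descending x y (z ∷ zs) path u x≡py)) (sym x≡pfin)) (penultimate-∈ y z zs))
    ... | inj₂ y≡px | inj₁ fin≡px =
      All¬⇒¬Any y∉ (subst (_∈ z ∷ zs) (trans fin≡px (sym y≡px)) (final-∈ z zs))
    ... | inj₂ y≡px | inj₂ x≡pfin with penultimate y z zs ≟ parent (final z zs)
    ...   | yes pen≡pfin =
      All¬⇒¬Any x∉ (subst (_∈ y ∷ z ∷ zs) (trans pen≡pfin (sym x≡pfin)) (penultimate-∈ y z zs))
    ...   | no pen≢pfin  =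
      <-asym (ascending x y (z ∷ zs) path u pen≢pfin) (rank-parent (Adj-sym G closing) x≡pfin)

  parent-acyclic : Acyclic G
  parent-acyclic record { verts = _ ∷ [] ; long = s≤s () }
  parent-acyclic record { verts = _ ∷ _ ∷ [] ; long = s≤s (s≤s ()) }
  parent-acyclic record { verts = x ∷ y ∷ z ∷ zs ; distinct = u ; linked = path ; closing = closing } =
    closed-path x y z zs u path (subst (λ v → Adj G v x) (last≡final x (y ∷ z ∷ zs)) closing)

⟨$⟩ʳ-injective : ∀ {m} (π : Permutation′ m) {i j} → π ⟨$⟩ʳ i ≡ π ⟨$⟩ʳ j → i ≡ j
⟨$⟩ʳ-injective π eq = trans (sym (Perm.inverseˡ π)) (trans (cong (π ⟨$⟩ˡ_) eq) (Perm.inverseˡ π))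

module _ {m : ℕ} (i j : Fin m) where

  transpose-matchˡ : Perm.transpose i j ⟨$⟩ʳ i ≡ j
  transpose-matchˡ rewrite dec-true (i ≟ i) refl = refl

  transpose-matchʳ : Perm.transpose i j ⟨$⟩ʳ j ≡ i
  transpose-matchʳ with j ≟ i
  ... | yes j≡i = j≡i
  ... | no _ rewrite dec-true (j ≟ j) refl = refl

  transpose-other : ∀ {k} → k ≢ i → k ≢ j → Perm.transpose i j ⟨$⟩ʳ k ≡ k
  transpose-other {k} k≢i k≢j rewrite dec-false (k ≟ i) k≢i | dec-false (k ≟ j) k≢j = refl

Cherry-transport : ∀ {n} (T₁ T₂ : Tree n) → Isomorphic T₁ T₂ → Cherry T₂ → Cherry T₁
Cherry-transport T₁ T₂ (π , adj≡) (l₁ , l₂ , v , l₁≢l₂ , p₁ , p₂) =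
  π⁻¹ l₁ , π⁻¹ l₂ , π⁻¹ v , (λ eq → l₁≢l₂ (⟨$⟩ʳ-injective (Perm.flip π) eq)) ,
  transport p₁ , transport p₂
  where
  π⁻¹ = π ⟨$⟩ˡ_
  adj-back : ∀ {x y} → Adj (graph T₂) x y → Adj (graph T₁) (π⁻¹ x) (π⁻¹ y)
  adj-back e = trans (adj≡ _ _) (subst₂ (Adj (graph T₂)) (sym (Perm.inverseʳ π)) (sym (Perm.inverseʳ π)) e)
  adj-forth : ∀ {x y} → Adj (graph T₁) x y → Adj (graph T₂) (π ⟨$⟩ʳ x) (π ⟨$⟩ʳ y)
  adj-forth e = trans (sym (adj≡ _ _)) e
  transport : ∀ {l u} → PendantAt T₂ l u → PendantAt T₁ (π⁻¹ l) (π⁻¹ u)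
  transport {l} (pendantAt e only) = pendantAt (adj-back e) λ w e′ →
    trans (sym (Perm.inverseˡ π))
          (cong π⁻¹ (only _ (subst (λ x → Adj (graph T₂) x _) (Perm.inverseʳ π) (adj-forth e′))))

Answered : ∀ {n} → List (Answer n) → Fin n → Fin n → Set
Answered H x y = ∃ λ d → ans x y d ∈ H

answer⇒adj≡ : ∀ {n} {H : List (Answer n)} (T₁ T₂ : Tree n) → Consistent T₁ H → Consistent T₂ H →
  ∀ {x y d} → ans x y d ∈ H → adj (graph T₁) x y ≡ adj (graph T₂) x y
answer⇒adj≡ T₁ T₂ c₁ c₂ a∈H =
  trans (Dist⇒adj T₁ (All.lookup c₁ a∈H)) (sym (Dist⇒adj T₂ (All.lookup c₂ a∈H)))

determined-by-parity : ∀ {n} (H : List (Answer n)) (r : Fin n) (depth : Fin n → ℕ) →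
  (∀ T → Consistent T H → ∀ v → Dist T v r (depth v)) →
  (∀ x y → parity (depth x) ≡ 0ℙ → parity (depth y) ≡ 1ℙ → Answered H x y) →
  Determined H
determined-by-parity H r depth dist answered T₁ T₂ c₁ c₂ = Perm.id , adj≡
  where
  same-parity : ∀ T → Consistent T H → ∀ {x y} → parity (depth x) ≡ parity (depth y) →
    adj (graph T) x y ≡ false
  same-parity T c = parity≡⇒adj≡false T (dist T c _) (dist T c _)
  both-false : ∀ {x y} → parity (depth x) ≡ parity (depth y) → adj (graph T₁) x y ≡ adj (graph T₂) x y
  both-false p≡ = trans (same-parity T₁ c₁ p≡) (sym (same-parity T₂ c₂ p≡))
  adj≡ : ∀ x y → adj (graph T₁) x y ≡ adj (graph T₂) x y
  adj≡ x y with parity (depth x) in px | parity (depth y) in py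
  ... | 0ℙ | 0ℙ = both-false (trans px (sym py))
  ... | 1ℙ | 1ℙ = both-false (trans px (sym py))
  ... | 0ℙ | 1ℙ = answer⇒adj≡ T₁ T₂ c₁ c₂ (proj₂ (answered x y px py))
  ... | 1ℙ | 0ℙ = trans (Graph.sym (graph T₁) x y)
    (trans (answer⇒adj≡ T₁ T₂ c₁ c₂ (proj₂ (answered y x py px))) (Graph.sym (graph T₂) y x))

lookupAnswer : ∀ {n} → Fin n → Fin n → List (Answer n) → ℕ
lookupAnswer x y []      = 0
lookupAnswer x y (a ∷ H) with Answer.qx a ≟ x | Answer.qy a ≟ y
... | yes _ | yes _ = Answer.qd a
... | _     | _     = lookupAnswer x y H

lookupAnswer-∈ : ∀ {n} {x y : Fin n} {d} H → ans x y d ∈ H → ans x y (lookupAnswer x y H) ∈ H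
lookupAnswer-∈ {x = x} {y} (a ∷ H) a∈ with Answer.qx a ≟ x | Answer.qy a ≟ y
... | yes refl | yes refl = here refl
lookupAnswer-∈ (a ∷ H) (here refl) | no x≢x | _      = ⊥-elim (x≢x refl)
lookupAnswer-∈ (a ∷ H) (there a∈)  | no _   | _      = there (lookupAnswer-∈ H a∈)
lookupAnswer-∈ (a ∷ H) (here refl) | yes _  | no y≢y = ⊥-elim (y≢y refl)
lookupAnswer-∈ (a ∷ H) (there a∈)  | yes _  | no _   = there (lookupAnswer-∈ H a∈)

Works-mono : ∀ {n} (T : Tree n) (A : Alg n) H {k k′} → k ≤ k′ → Works T A H k → Works T A H k′
Works-mono T done          H k≤k′     w = w
Works-mono T (ask x y _ f) H {suc k} {suc k′} (s≤s k≤k′) w =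
  λ d dist → Works-mono T (f d) _ k≤k′ (w d dist)

module _ {n : ℕ} where

  queryAll : List (Fin n × Fin n) → List (Answer n) → (List (Answer n) → Alg n) → Alg n
  queryAll []             H k = k H
  queryAll ((x , y) ∷ qs) H k with x ≟ y
  ... | yes _  = queryAll qs H k
  ... | no x≢y = ask x y x≢y λ d → queryAll qs (ans x y d ∷ H) k

  AnswersAll : List (Fin n × Fin n) → List (Answer n) → Set
  AnswersAll qs H = ∀ {x y} → (x , y) ∈ qs → x ≢ y → Answered H x y

  Works-queryAll : (T : Tree n) (qs : List (Fin n × Fin n)) (H : List (Answer n))
    (k : List (Answer n) → Alg n) (m : ℕ) →
    (∀ H′ → H ⊆ H′ → AnswersAll qs H′ → Works T (k H′) H′ m) →
    Works T (queryAll qs H k) H (length qs + m)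
  Works-queryAll T []             H k m works = works H (λ a∈ → a∈) λ ()
  Works-queryAll T ((x , y) ∷ qs) H k m works with x ≟ y
  ... | yes x≡y = Works-mono T (queryAll qs H k) H (n≤1+n _)
    (Works-queryAll T qs H k m λ H′ H⊆H′ all → works H′ H⊆H′ λ
      { (here refl) x≢y → ⊥-elim (x≢y x≡y)
      ; (there q∈)  → all q∈ })
  ... | no _ = λ d _ → Works-queryAll T qs (ans x y d ∷ H) k m λ H′ H⊆H′ all →
    works H′ (H⊆H′ ∘ there) λ
      { (here refl) _ → d , H⊆H′ (here refl)
      ; (there q∈)  → all q∈ }

length-filter-parity : {A : Set} (p : A → Parity) (xs : List A) →
  length (List.filter (λ x → p x Parity.≟ 0ℙ) xs) + length (List.filter (λ x → p x Parity.≟ 1ℙ) xs)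
    ≡ length xs
length-filter-parity p []       = refl
length-filter-parity p (x ∷ xs) with p x
... | 0ℙ = cong suc (length-filter-parity p xs)
... | 1ℙ = trans (+-suc _ _) (cong suc (length-filter-parity p xs))

length-cartesianProduct : {A B : Set} (xs : List A) (ys : List B) →
  length (List.cartesianProduct xs ys) ≡ length xs * length ys
length-cartesianProduct []       ys = refl
length-cartesianProduct (x ∷ xs) ys = trans (length-++ (List.map (x ,_) ys))
  (cong₂ _+_ (length-map (x ,_) ys) (length-cartesianProduct xs ys))

[2a+d]²≡4a[a+d]+d² : ∀ a d → (a + (a + d)) * (a + (a + d)) ≡ 4 * (a * (a + d)) + d * d
[2a+d]²≡4a[a+d]+d² = solve-∀

4*m*n≤[m+n]²-ordered : ∀ {m n} → m ≤ n → 4 * (m * n) ≤ (m + n) * (m + n)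
4*m*n≤[m+n]²-ordered {m} m≤n with d , refl ← m≤n⇒∃[o]m+o≡n m≤n =
  subst (4 * (m * (m + d)) ≤_) (sym ([2a+d]²≡4a[a+d]+d² m d)) (m≤m+n _ (d * d))

4*m*n≤[m+n]² : ∀ m n → 4 * (m * n) ≤ (m + n) * (m + n)
4*m*n≤[m+n]² m n with ≤-total m n
... | inj₁ m≤n = 4*m*n≤[m+n]²-ordered m≤n
... | inj₂ n≤m = subst₂ _≤_ (cong (4 *_) (*-comm n m)) (cong₂ _*_ (+-comm n m) (+-comm n m))
  (4*m*n≤[m+n]²-ordered n≤m)

module ParityStrategy (n : ℕ) where
  private
    N = suc n

  depth : List (Answer N) → Fin N → ℕ
  depth H zero    = 0
  depth H (suc i) = lookupAnswer (suc i) zero H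

  toRoot : List (Fin N × Fin N)
  toRoot = List.map (λ i → suc i , zero) (List.allFin n)

  depthParity? : (H : List (Answer N)) (p : Parity) (v : Fin N) → Dec (parity (depth H v) ≡ p)
  depthParity? H p v = parity (depth H v) Parity.≟ p

  evens odds : List (Answer N) → List (Fin N)
  evens H = List.filter (depthParity? H 0ℙ) (List.allFin N)
  odds  H = List.filter (depthParity? H 1ℙ) (List.allFin N)

  oppositePairs : List (Answer N) → List (Fin N × Fin N)
  oppositePairs H = List.cartesianProduct (evens H) (odds H)

  strategy : Alg N
  strategy = queryAll toRoot [] λ H → queryAll (oppositePairs H) H λ _ → done

  length-oppositePairs : ∀ H → length (oppositePairs H) ≤ N * N / 4
  length-oppositePairs H = begin
    length (oppositePairs H)  ≡⟨ length-cartesianProduct (evens H) (odds H) ⟩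
    a * b                     ≡⟨ m*n/n≡m (a * b) 4 ⟨
    a * b * 4 / 4             ≤⟨ /-monoˡ-≤ 4 4ab≤N² ⟩
    N * N / 4                 ∎
    where
    open ≤-Reasoning
    a = length (evens H)
    b = length (odds H)
    a+b≡N : a + b ≡ N
    a+b≡N = trans (length-filter-parity (parity ∘ depth H) (List.allFin N))
                  (length-tabulate {n = N} (λ i → i))
    4ab≤N² : a * b * 4 ≤ N * N
    4ab≤N² = subst₂ _≤_ (*-comm 4 (a * b)) (cong₂ _*_ a+b≡N a+b≡N) (4*m*n≤[m+n]² a b)

  length-toRoot : length toRoot ≡ n
  length-toRoot = trans (length-map _ (List.allFin n)) (length-tabulate {n = n} (λ i → i))

  depths-known : ∀ {H} → AnswersAll toRoot H → ∀ H′ → H ⊆ H′ →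
    ∀ T → Consistent T H′ → ∀ v → Dist T v zero (depth H v)
  depths-known answered H′ H⊆H′ T c zero    = here , λ _ _ → z≤n
  depths-known {H} answered H′ H⊆H′ T c (suc i) =
    let d , a∈H = answered (∈-map⁺ _ (∈-allFin i)) λ () in
    All.lookup c (H⊆H′ (lookupAnswer-∈ H a∈H))

  opposite-answered : ∀ H H′ → AnswersAll (oppositePairs H) H′ →
    ∀ x y → parity (depth H x) ≡ 0ℙ → parity (depth H y) ≡ 1ℙ → Answered H′ x y
  opposite-answered H H′ answered x y px py =
    answered (∈-cartesianProduct⁺ (∈-filter⁺ (depthParity? H 0ℙ) (∈-allFin x) px)
                                  (∈-filter⁺ (depthParity? H 1ℙ) (∈-allFin y) py))
             λ { refl → case trans (sym px) py of λ () }

  Works-oppositePairs : ∀ T H → AnswersAll toRoot H →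
    Works T (queryAll (oppositePairs H) H λ _ → done) H (N * N / 4)
  Works-oppositePairs T H depths =
    Works-mono T _ H (subst (_≤ N * N / 4) (sym (+-identityʳ _)) (length-oppositePairs H))
      (Works-queryAll T (oppositePairs H) H _ 0 λ H′ H⊆H′ pairs →
        determined-by-parity H′ zero (depth H) (depths-known depths H′ H⊆H′) (opposite-answered H H′ pairs))

  Works-strategy : ∀ T → Works T strategy [] (n + N * N / 4)
  Works-strategy T = subst (Works T strategy []) (cong (_+ N * N / 4) length-toRoot)
    (Works-queryAll T toRoot [] _ _ λ H _ depths → Works-oppositePairs T H depths)

𝟙 : Bool → ℕ
𝟙 true  = 1
𝟙 false = 0

𝟙*≤ : ∀ b n → 𝟙 b * n ≤ n
𝟙*≤ true  n = ≤-reflexive (+-identityʳ n)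
𝟙*≤ false n = z≤n

𝟙-∨ : ∀ a b → 𝟙 (a ∨ b) ≤ 𝟙 a + 𝟙 b
𝟙-∨ true  _ = s≤s z≤n
𝟙-∨ false _ = ≤-refl

𝟙-∧ : ∀ a b → 𝟙 (a ∧ b) ≡ 𝟙 a * 𝟙 b
𝟙-∧ true  true  = refl
𝟙-∧ true  false = refl
𝟙-∧ false _     = refl

δ : ∀ {m} → Fin m → Fin m → ℕ
δ a x = 𝟙 (does (x ≟ a))

δ-permute : ∀ {m} (π : Permutation′ m) (i y : Fin m) → δ i (π ⟨$⟩ʳ y) ≡ δ (π ⟨$⟩ˡ i) y
δ-permute π i y = cong 𝟙 (does-⇔ (mk⇔ to from) (π ⟨$⟩ʳ y ≟ i) (y ≟ π ⟨$⟩ˡ i))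
  where
  to : π ⟨$⟩ʳ y ≡ i → y ≡ π ⟨$⟩ˡ i
  to πy≡i = trans (sym (Perm.inverseˡ π)) (cong (π ⟨$⟩ˡ_) πy≡i)
  from : y ≡ π ⟨$⟩ˡ i → π ⟨$⟩ʳ y ≡ i
  from y≡π⁻¹i = trans (cong (π ⟨$⟩ʳ_) y≡π⁻¹i) (Perm.inverseʳ π)

∑-mono-≤ : ∀ {m} {f g : Fin m → ℕ} → (∀ i → f i ≤ g i) → ∑[ i < m ] f i ≤ ∑[ i < m ] g i
∑-mono-≤ {zero}  _   = z≤n
∑-mono-≤ {suc m} f≤g = +-mono-≤ (f≤g zero) (∑-mono-≤ (f≤g ∘ suc))

∑-δ : ∀ {m} (a : Fin m) (g : Fin m → ℕ) → ∑[ x < m ] (δ a x * g x) ≡ g a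
∑-δ {suc m} zero    g = trans (cong₂ _+_ (+-identityʳ (g zero)) (sum-replicate-zero m)) (+-identityʳ (g zero))
∑-δ {suc m} (suc a) g = ∑-δ a (g ∘ suc)

∑-𝟙 : ∀ {m} → ∑[ x < m ] 1 ≡ m
∑-𝟙 {zero}  = refl
∑-𝟙 {suc m} = cong suc ∑-𝟙

module _ {m : ℕ} (u : Fin m → Bool) where

  count : ℕ
  count = ∑[ x < m ] 𝟙 (u x)

  rowWeight : (Fin m → Fin m → ℕ) → Fin m → ℕ
  rowWeight w x = ∑[ y < m ] (𝟙 (u y) * w x y)

  pairWeight : (Fin m → Fin m → ℕ) → ℕ
  pairWeight w = ∑[ x < m ] (𝟙 (u x) * rowWeight w x)

  pairWeight-mono-≤ : ∀ {w w′} → (∀ x y → w x y ≤ w′ x y) → pairWeight w ≤ pairWeight w′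
  pairWeight-mono-≤ w≤w′ =
    ∑-mono-≤ λ x → *-monoʳ-≤ (𝟙 (u x)) (∑-mono-≤ λ y → *-monoʳ-≤ (𝟙 (u y)) (w≤w′ x y))

  pairWeight-+ : ∀ w w′ → pairWeight (λ x y → w x y + w′ x y) ≡ pairWeight w + pairWeight w′
  pairWeight-+ w w′ =
    trans (sum-cong-≗ λ x → trans (cong (𝟙 (u x) *_) (row x)) (*-distribˡ-+ (𝟙 (u x)) _ _))
          (∑-distrib-+ (λ x → 𝟙 (u x) * rowWeight w x) (λ x → 𝟙 (u x) * rowWeight w′ x))
    where
    row : ∀ x → rowWeight (λ x y → w x y + w′ x y) x ≡ rowWeight w x + rowWeight w′ x
    row x = trans (sum-cong-≗ λ y → *-distribˡ-+ (𝟙 (u y)) (w x y) (w′ x y))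
      (∑-distrib-+ (λ y → 𝟙 (u y) * w x y) (λ y → 𝟙 (u y) * w′ x y))

  pairWeight-point : ∀ c a b → pairWeight (λ x y → c * (δ a x * δ b y)) ≤ c
  pairWeight-point c a b = begin
    pairWeight (λ x y → c * (δ a x * δ b y))
      ≤⟨ ∑-mono-≤ (λ x → ≤-trans (𝟙*≤ (u x) _) (∑-mono-≤ λ y → 𝟙*≤ (u y) _)) ⟩
    ∑[ x < m ] (∑[ y < m ] (c * (δ a x * δ b y)))
      ≡⟨ sum-cong-≗ (λ x → trans (sum-cong-≗ λ y → rearrange c (δ a x) (δ b y)) (∑-δ b _)) ⟩
    ∑[ x < m ] (δ a x * c)
      ≡⟨ ∑-δ a _ ⟩
    c ∎
    where
    open ≤-Reasoning
    rearrange : ∀ c p q → c * (p * q) ≡ q * (p * c)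
    rearrange = solve-∀

  pairWeight-bump : ∀ {w w′} c a b → (∀ x y → w′ x y ≤ w x y + c * (δ a x * δ b y)) →
    pairWeight w′ ≤ pairWeight w + c
  pairWeight-bump {w} {w′} c a b w′≤ = begin
    pairWeight w′                                            ≤⟨ pairWeight-mono-≤ w′≤ ⟩
    pairWeight (λ x y → w x y + c * (δ a x * δ b y))         ≡⟨ pairWeight-+ w _ ⟩
    pairWeight w + pairWeight (λ x y → c * (δ a x * δ b y))  ≤⟨ +-monoʳ-≤ _ (pairWeight-point c a b) ⟩
    pairWeight w + c                                         ∎
    where open ≤-Reasoning

  pairWeight-permuteʳ : (π : Permutation′ m) → (∀ y → u (π ⟨$⟩ʳ y) ≡ u y) → ∀ w →
    pairWeight (λ x y → w x (π ⟨$⟩ʳ y)) ≡ pairWeight w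
  pairWeight-permuteʳ π u∘π≡u w = sum-cong-≗ λ x → cong (𝟙 (u x) *_) (begin
    ∑[ y < m ] (𝟙 (u y) * w x (π ⟨$⟩ʳ y))
      ≡⟨ sum-cong-≗ (λ y → cong (λ b → 𝟙 b * w x (π ⟨$⟩ʳ y)) (sym (u∘π≡u y))) ⟩
    ∑[ y < m ] (𝟙 (u (π ⟨$⟩ʳ y)) * w x (π ⟨$⟩ʳ y))
      ≡⟨ ∑-permute (λ y → 𝟙 (u y) * w x y) π ⟨
    rowWeight w x ∎)
    where open ≡-Reasoning

  rowWeight-lower : ∀ c w x → (∀ y → u y ≡ true → c ≤ w x y) → c * count ≤ rowWeight w x
  rowWeight-lower c w x c≤w = begin
    c * count                       ≡⟨ *-distribˡ-sum c (λ y → 𝟙 (u y)) ⟩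
    ∑[ y < m ] (c * 𝟙 (u y))        ≤⟨ ∑-mono-≤ entry ⟩
    rowWeight w x                   ∎
    where
    open ≤-Reasoning
    entry : ∀ y → c * 𝟙 (u y) ≤ 𝟙 (u y) * w x y
    entry y with u y in uy
    ... | false = ≤-reflexive (*-zeroʳ c)
    ... | true  = subst₂ _≤_ (sym (*-identityʳ c)) (sym (+-identityʳ (w x y))) (c≤w y uy)

  pairWeight-lower : ∀ w → (∀ x y → u x ≡ true → u y ≡ true → x ≢ y → 1 ≤ w x y) →
    count * count ≤ pairWeight w + count
  pairWeight-lower w w≥1 = begin
    count * count                                   ≡⟨ *-distribʳ-sum count (λ x → 𝟙 (u x)) ⟩
    ∑[ x < m ] (𝟙 (u x) * count)                    ≤⟨ ∑-mono-≤ row ⟩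
    ∑[ x < m ] (𝟙 (u x) * rowWeight w x + 𝟙 (u x))  ≡⟨ ∑-distrib-+ (λ x → 𝟙 (u x) * rowWeight w x) _ ⟩
    pairWeight w + count                            ∎
    where
    open ≤-Reasoning
    row : ∀ x → 𝟙 (u x) * count ≤ 𝟙 (u x) * rowWeight w x + 𝟙 (u x)
    row x with u x in ux
    ... | false = z≤n
    ... | true  = subst₂ _≤_ (sym (+-identityʳ count)) (cong (_+ 1) (sym (+-identityʳ (rowWeight w x))))
      (begin
        count                                 ≤⟨ ∑-mono-≤ entry ⟩
        ∑[ y < m ] (𝟙 (u y) * w x y + δ x y)  ≡⟨ ∑-distrib-+ (λ y → 𝟙 (u y) * w x y) (δ x) ⟩
        rowWeight w x + ∑[ y < m ] (δ x y)    ≡⟨ cong (rowWeight w x +_) ∑δ≡1 ⟩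
        rowWeight w x + 1                     ∎)
      where
      ∑δ≡1 : ∑[ y < m ] (δ x y) ≡ 1
      ∑δ≡1 = trans (sum-cong-≗ λ y → sym (*-identityʳ (δ x y))) (∑-δ x (λ _ → 1))
      entry : ∀ y → 𝟙 (u y) ≤ 𝟙 (u y) * w x y + δ x y
      entry y with y ≟ x
      ... | yes refl = subst (λ b → 𝟙 b ≤ 𝟙 b * w y y + 1) (sym ux) (m≤n+m 1 _)
      ... | no y≢x with u y in uy
      ...   | false = z≤n
      ...   | true  = ≤-trans (w≥1 x y ux uy (≢-sym y≢x))
                              (≤-reflexive (sym (trans (+-identityʳ _) (+-identityʳ _))))

remove : ∀ {m} → (Fin m → Bool) → Fin m → Fin m → Bool
remove u j x = u x ∧ not (does (x ≟ j))

remove-self : ∀ {m} (u : Fin m → Bool) j → remove u j j ≡ false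
remove-self u j rewrite dec-true (j ≟ j) refl = ∧-zeroʳ-Bool (u j)

remove-false : ∀ {m} (u : Fin m → Bool) j {y} → u y ≡ false → remove u j y ≡ false
remove-false u j uy rewrite uy = refl

remove-true : ∀ {m} (u : Fin m → Bool) j {y} → remove u j y ≡ true → u y ≡ true × y ≢ j
remove-true u j {y} e with u y | y ≟ j
... | true  | no y≢j = refl , y≢j
... | true  | yes _  = ⊥-elim (clash e refl)
... | false | _      = ⊥-elim (clash e refl)

module _ {m : ℕ} (u : Fin m → Bool) {j : Fin m} (j∈u : u j ≡ true) where

  private
    u′ = remove u j

    𝟙-remove : ∀ x → 𝟙 (u x) ≡ 𝟙 (u′ x) + δ j x
    𝟙-remove x with x ≟ j
    ... | yes refl rewrite j∈u = refl
    ... | no _ with u x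
    ...   | true  = refl
    ...   | false = refl

    split : ∀ g → ∑[ x < m ] (𝟙 (u x) * g x) ≡ ∑[ x < m ] (𝟙 (u′ x) * g x) + g j
    split g = begin
      ∑[ x < m ] (𝟙 (u x) * g x)
        ≡⟨ sum-cong-≗ (λ x → trans (cong (_* g x) (𝟙-remove x)) (*-distribʳ-+ (g x) (𝟙 (u′ x)) _)) ⟩
      ∑[ x < m ] (𝟙 (u′ x) * g x + δ j x * g x)
        ≡⟨ ∑-distrib-+ (λ x → 𝟙 (u′ x) * g x) (λ x → δ j x * g x) ⟩
      ∑[ x < m ] (𝟙 (u′ x) * g x) + ∑[ x < m ] (δ j x * g x)
        ≡⟨ cong (∑[ x < m ] (𝟙 (u′ x) * g x) +_) (∑-δ j g) ⟩
      ∑[ x < m ] (𝟙 (u′ x) * g x) + g j ∎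
      where open ≡-Reasoning

  count-remove : count u ≡ suc (count u′)
  count-remove = trans (trans (sum-cong-≗ λ x → sym (*-identityʳ (𝟙 (u x)))) (split (λ _ → 1)))
    (trans (cong (_+ 1) (sum-cong-≗ λ x → *-identityʳ (𝟙 (u′ x)))) (+-comm _ 1))

  pairWeight-remove : ∀ w → pairWeight u′ w + rowWeight u′ (λ x y → w x y + w y x) j ≤ pairWeight u w
  pairWeight-remove w = begin
    pairWeight u′ w + rowWeight u′ (λ x y → w x y + w y x) j  ≡⟨ cong (pairWeight u′ w +_) row-sym ⟩
    pairWeight u′ w + (rowWeight u′ w j + column)             ≡⟨ swap (pairWeight u′ w) _ column ⟩
    pairWeight u′ w + column + rowWeight u′ w j               ≤⟨ +-monoʳ-≤ (pairWeight u′ w + column) ≤-w-jj ⟩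
    pairWeight u′ w + column + (rowWeight u′ w j + w j j)     ≡⟨ decomposition ⟨
    pairWeight u w                                            ∎
    where
    open ≤-Reasoning
    column = ∑[ x < m ] (𝟙 (u′ x) * w x j)
    ≤-w-jj = m≤m+n (rowWeight u′ w j) (w j j)
    swap : ∀ a b c → a + (b + c) ≡ a + c + b
    swap = solve-∀
    row-sym : rowWeight u′ (λ x y → w x y + w y x) j ≡ rowWeight u′ w j + column
    row-sym = trans (sum-cong-≗ λ y → *-distribˡ-+ (𝟙 (u′ y)) (w j y) (w y j))
      (∑-distrib-+ (λ y → 𝟙 (u′ y) * w j y) (λ y → 𝟙 (u′ y) * w y j))
    decomposition : pairWeight u w ≡ pairWeight u′ w + column + (rowWeight u′ w j + w j j)
    decomposition = trans (split (rowWeight u w)) (cong₂ _+_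
      (trans (sum-cong-≗ λ x → trans (cong (𝟙 (u′ x) *_) (split (w x))) (*-distribˡ-+ (𝟙 (u′ x)) _ _))
             (∑-distrib-+ (λ x → 𝟙 (u′ x) * rowWeight u′ w x) (λ x → 𝟙 (u′ x) * w x j)))
      (split (w j)))

addPair : ∀ {m} → (Fin m → Fin m → Bool) → Fin m → Fin m → Fin m → Fin m → Bool
addPair R a b x y = R x y ∨ (does (x ≟ a) ∧ does (y ≟ b))

module _ {m : ℕ} (R : Fin m → Fin m → Bool) (a b : Fin m) where

  𝟙-addPair : ∀ x y → 𝟙 (addPair R a b x y) ≤ 𝟙 (R x y) + δ a x * δ b y
  𝟙-addPair x y =
    ≤-trans (𝟙-∨ (R x y) _) (≤-reflexive (cong (𝟙 (R x y) +_) (𝟙-∧ (does (x ≟ a)) (does (y ≟ b)))))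

  addPair-new : addPair R a b a b ≡ true
  addPair-new rewrite dec-true (a ≟ a) refl | dec-true (b ≟ b) refl = ∨-zeroʳ-Bool (R a b)

  addPair-old : ∀ {x y} → R x y ≡ true → addPair R a b x y ≡ true
  addPair-old Rxy rewrite Rxy = refl

  addPair-false : ∀ {x y} → R x y ≡ false → (x ≡ a → y ≢ b) → addPair R a b x y ≡ false
  addPair-false {x} {y} Rxy ¬ab rewrite Rxy with x ≟ a | y ≟ b
  ... | yes x≡a | yes y≡b = ⊥-elim (¬ab x≡a y≡b)
  ... | yes _   | no _    = refl
  ... | no _    | _       = refl

module Spiders (m r : ℕ) where

  data Kind : Set where
    centre : Kind
    inner  : Fin m → Kind
    outer  : Fin m → Kind
    extra  : Fin r → Kind

  N : ℕ
  N = suc (m + (m + r))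

  toFin : Kind → Fin N
  toFin centre    = zero
  toFin (inner i) = suc (join m (m + r) (inj₁ i))
  toFin (outer j) = suc (join m (m + r) (inj₂ (join m r (inj₁ j))))
  toFin (extra t) = suc (join m (m + r) (inj₂ (join m r (inj₂ t))))

  private
    fromSplit′ : Fin m ⊎ Fin r → Kind
    fromSplit′ (inj₁ j) = outer j
    fromSplit′ (inj₂ t) = extra t

    fromSplit : Fin m ⊎ Fin (m + r) → Kind
    fromSplit (inj₁ i) = inner i
    fromSplit (inj₂ y) = fromSplit′ (splitAt m y)

  fromFin : Fin N → Kind
  fromFin zero    = centre
  fromFin (suc x) = fromSplit (splitAt m x)

  fromFin-toFin : ∀ k → fromFin (toFin k) ≡ k
  fromFin-toFin centre    = refl
  fromFin-toFin (inner i) rewrite splitAt-join m (m + r) (inj₁ i) = refl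
  fromFin-toFin (outer j)
    rewrite splitAt-join m (m + r) (inj₂ (join m r (inj₁ j))) | splitAt-join m r (inj₁ j) = refl
  fromFin-toFin (extra t)
    rewrite splitAt-join m (m + r) (inj₂ (join m r (inj₂ t))) | splitAt-join m r (inj₂ t) = refl

  toFin-fromFin : ∀ x → toFin (fromFin x) ≡ x
  toFin-fromFin zero    = refl
  toFin-fromFin (suc x) = trans (toFin-fromSplit (splitAt m x)) (cong suc (join-splitAt m (m + r) x))
    where
    toFin-fromSplit′ : ∀ s → toFin (fromSplit′ s) ≡ suc (join m (m + r) (inj₂ (join m r s)))
    toFin-fromSplit′ (inj₁ j) = refl
    toFin-fromSplit′ (inj₂ t) = refl
    toFin-fromSplit : ∀ s → toFin (fromSplit s) ≡ suc (join m (m + r) s)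
    toFin-fromSplit (inj₁ i) = refl
    toFin-fromSplit (inj₂ y) = trans (toFin-fromSplit′ (splitAt m y))
                                     (cong (λ z → suc (join m (m + r) (inj₂ z))) (join-splitAt m r y))

  toFin-injective : ∀ {k k′} → toFin k ≡ toFin k′ → k ≡ k′
  toFin-injective {k} {k′} eq = trans (sym (fromFin-toFin k)) (trans (cong fromFin eq) (fromFin-toFin k′))

  fromFin-injective : ∀ {x y} → fromFin x ≡ fromFin y → x ≡ y
  fromFin-injective {x} {y} eq = trans (sym (toFin-fromFin x)) (trans (cong toFin eq) (toFin-fromFin y))

  inner-injective : ∀ {i i′} → inner i ≡ inner i′ → i ≡ i′
  inner-injective refl = refl

  toFin-≢ : ∀ k k′ → k ≢ k′ → toFin k ≢ toFin k′
  toFin-≢ _ _ k≢k′ eq = k≢k′ (toFin-injective eq)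

  parentᴷ : (Fin m → Fin m) → Kind → Kind
  parentᴷ f centre    = centre
  parentᴷ f (inner _) = centre
  parentᴷ f (outer j) = inner (f j)
  parentᴷ f (extra _) = centre

  rankᴷ : Kind → ℕ
  rankᴷ centre    = 0
  rankᴷ (inner _) = 1
  rankᴷ (outer _) = 2
  rankᴷ (extra _) = 1

  module _ (f : Fin m → Fin m) where

    adjᴷ : Kind → Kind → Bool
    adjᴷ centre    (inner _) = true
    adjᴷ (inner _) centre    = true
    adjᴷ centre    (extra _) = true
    adjᴷ (extra _) centre    = true
    adjᴷ (inner i) (outer j) = does (f j ≟ i)
    adjᴷ (outer j) (inner i) = does (f j ≟ i)
    adjᴷ _         _         = false

    private
      adjᴷ-sym : ∀ k k′ → adjᴷ k k′ ≡ adjᴷ k′ k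
      adjᴷ-sym centre    centre    = refl
      adjᴷ-sym centre    (inner _) = refl
      adjᴷ-sym centre    (outer _) = refl
      adjᴷ-sym centre    (extra _) = refl
      adjᴷ-sym (inner _) centre    = refl
      adjᴷ-sym (inner _) (inner _) = refl
      adjᴷ-sym (inner _) (outer _) = refl
      adjᴷ-sym (inner _) (extra _) = refl
      adjᴷ-sym (outer _) centre    = refl
      adjᴷ-sym (outer _) (inner _) = refl
      adjᴷ-sym (outer _) (outer _) = refl
      adjᴷ-sym (outer _) (extra _) = refl
      adjᴷ-sym (extra _) centre    = refl
      adjᴷ-sym (extra _) (inner _) = refl
      adjᴷ-sym (extra _) (outer _) = refl
      adjᴷ-sym (extra _) (extra _) = refl

      adjᴷ-irrefl : ∀ k → adjᴷ k k ≡ false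
      adjᴷ-irrefl centre    = refl
      adjᴷ-irrefl (inner _) = refl
      adjᴷ-irrefl (outer _) = refl
      adjᴷ-irrefl (extra _) = refl

    spiderGraph : Graph N
    spiderGraph = record
      { adj    = λ x y → adjᴷ (fromFin x) (fromFin y)
      ; sym    = λ x y → adjᴷ-sym (fromFin x) (fromFin y)
      ; irrefl = λ x → adjᴷ-irrefl (fromFin x)
      }

    private
      G = spiderGraph

    Adjᴷ : Kind → Kind → Set
    Adjᴷ k k′ = Adj G (toFin k) (toFin k′)

    adjᴷ⇒Adj : ∀ {k k′} → adjᴷ k k′ ≡ true → Adjᴷ k k′
    adjᴷ⇒Adj {k} {k′} =
      subst₂ (λ a b → adjᴷ a b ≡ true) (sym (fromFin-toFin k)) (sym (fromFin-toFin k′))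

    Adj⇒adjᴷ : ∀ {k k′} → Adjᴷ k k′ → adjᴷ k k′ ≡ true
    Adj⇒adjᴷ {k} {k′} = subst₂ (λ a b → adjᴷ a b ≡ true) (fromFin-toFin k) (fromFin-toFin k′)

    f≟f : ∀ j → does (f j ≟ f j) ≡ true
    f≟f j = dec-true (f j ≟ f j) refl

    Adj-parent : ∀ k → k ≢ centre → Adjᴷ k (parentᴷ f k)
    Adj-parent centre    k≢c = ⊥-elim (k≢c refl)
    Adj-parent (inner i) _   = adjᴷ⇒Adj {inner i} {centre} refl
    Adj-parent (outer j) _   = adjᴷ⇒Adj {outer j} {inner (f j)} (f≟f j)
    Adj-parent (extra t) _   = adjᴷ⇒Adj {extra t} {centre} refl

    Adj-child : ∀ k → k ≢ centre → Adjᴷ (parentᴷ f k) k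
    Adj-child k k≢c = Adj-sym G {toFin k} {toFin (parentᴷ f k)} (Adj-parent k k≢c)

    private
      edge⇒parentᴷ : ∀ k k′ → adjᴷ k k′ ≡ true → k ≡ parentᴷ f k′ ⊎ k′ ≡ parentᴷ f k
      edge⇒parentᴷ centre    (inner _) _ = inj₁ refl
      edge⇒parentᴷ (inner _) centre    _ = inj₂ refl
      edge⇒parentᴷ centre    (extra _) _ = inj₁ refl
      edge⇒parentᴷ (extra _) centre    _ = inj₂ refl
      edge⇒parentᴷ (inner i) (outer j) e = inj₁ (cong inner (sym (does⇒witness (f j ≟ i) e)))
      edge⇒parentᴷ (outer j) (inner i) e = inj₂ (cong inner (sym (does⇒witness (f j ≟ i) e)))

      rank-parentᴷ : ∀ k → k ≢ centre → rankᴷ (parentᴷ f k) < rankᴷ k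
      rank-parentᴷ centre    k≢c = ⊥-elim (k≢c refl)
      rank-parentᴷ (inner _) _   = s≤s z≤n
      rank-parentᴷ (outer _) _   = s≤s (s≤s z≤n)
      rank-parentᴷ (extra _) _   = s≤s z≤n

      parent : Fin N → Fin N
      parent x = toFin (parentᴷ f (fromFin x))

      edge⇒parent : ∀ {x y} → Adj G x y → x ≡ parent y ⊎ y ≡ parent x
      edge⇒parent {x} {y} e with edge⇒parentᴷ (fromFin x) (fromFin y) e
      ... | inj₁ eq = inj₁ (trans (sym (toFin-fromFin x)) (cong toFin eq))
      ... | inj₂ eq = inj₂ (trans (sym (toFin-fromFin y)) (cong toFin eq))

      rank-parent : ∀ {x y} → Adj G x y → x ≡ parent y → rankᴷ (fromFin x) < rankᴷ (fromFin y)
      rank-parent {y = y} e refl =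
        subst (_< rankᴷ (fromFin y)) (cong rankᴷ (sym (fromFin-toFin _)))
              (rank-parentᴷ (fromFin y) y≢centre)
        where
        y≢centre : fromFin y ≢ centre
        y≢centre eq = Adj⇒≢ G e (trans (cong (toFin ∘ parentᴷ f) eq)
                                       (sym (trans (sym (toFin-fromFin y)) (cong toFin eq))))

      toCentreᴷ : ∀ k → ∃ λ d → Walk G (toFin k) (toFin centre) d
      toCentreᴷ centre    = 0 , here
      toCentreᴷ (inner i) = 1 , step (Adj-parent (inner i) λ ()) here
      toCentreᴷ (outer j) = 2 , step (Adj-parent (outer j) λ ()) (proj₂ (toCentreᴷ (inner (f j))))
      toCentreᴷ (extra t) = 1 , step (Adj-parent (extra t) λ ()) here

      toCentre : ∀ x → ∃ λ d → Walk G x (toFin centre) d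
      toCentre x = subst (λ v → ∃ λ d → Walk G v (toFin centre) d) (toFin-fromFin x) (toCentreᴷ (fromFin x))

      spider-connected : Connected G
      spider-connected x y = _ , walk-append G (proj₂ (toCentre x)) (walk-reverse G (proj₂ (toCentre y)))

    spider : Tree N
    spider = record
      { graph     = G
      ; connected = spider-connected
      ; acyclic   = parent-acyclic G parent (rankᴷ ∘ fromFin) edge⇒parent
                                   (λ {x} {y} → rank-parent {x} {y})
      }

    Distᴷ : Kind → Kind → ℕ → Set
    Distᴷ k k′ = Dist spider (toFin k) (toFin k′)

    private
      Adj⇒adjᴷ-fromFin : ∀ k w → Adj G (toFin k) w → adjᴷ k (fromFin w) ≡ true
      Adj⇒adjᴷ-fromFin k w = subst (λ a → adjᴷ a (fromFin w) ≡ true) (fromFin-toFin k)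

      ≡toFin : ∀ {w k} → fromFin w ≡ k → w ≡ toFin k
      ≡toFin {w} eq = trans (sym (toFin-fromFin w)) (cong toFin eq)

    outer-pendant : ∀ j → PendantAt spider (toFin (outer j)) (toFin (inner (f j)))
    outer-pendant j = pendantAt (Adj-parent (outer j) (λ ())) λ w e →
      only w (fromFin w) refl (Adj⇒adjᴷ-fromFin (outer j) w e)
      where
      only : ∀ w k → fromFin w ≡ k → adjᴷ (outer j) k ≡ true → w ≡ toFin (inner (f j))
      only w (inner i) eq e = ≡toFin (trans eq (cong inner (sym (does⇒witness (f j ≟ i) e))))
      only w centre    _  ()
      only w (outer _) _  ()
      only w (extra _) _  ()

    extra-pendant : ∀ t → PendantAt spider (toFin (extra t)) (toFin centre)
    extra-pendant t = pendantAt (Adj-parent (extra t) (λ ())) λ w e →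
      only w (fromFin w) refl (Adj⇒adjᴷ-fromFin (extra t) w e)
      where
      only : ∀ w k → fromFin w ≡ k → adjᴷ (extra t) k ≡ true → w ≡ toFin centre
      only w centre    eq _ = ≡toFin eq
      only w (inner _) _  ()
      only w (outer _) _  ()
      only w (extra _) _  ()

    Dist-inner-centre : ∀ i → Distᴷ (inner i) centre 1
    Dist-inner-centre i = Adj⇒Dist-1 spider (Adj-parent (inner i) λ ())

    Dist-extra-centre : ∀ t → Distᴷ (extra t) centre 1
    Dist-extra-centre t = Adj⇒Dist-1 spider (PendantAt.adjacent (extra-pendant t))

    Dist-outer-centre : ∀ j → Distᴷ (outer j) centre 2
    Dist-outer-centre j =
      Dist-PendantAt spider (outer-pendant j) (toFin-≢ (outer j) centre λ ()) (Dist-inner-centre (f j))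

    Dist-inner-inner : ∀ {i i′} → i ≢ i′ → Distᴷ (inner i) (inner i′) 2
    Dist-inner-inner {i} {i′} i≢i′ =
      Dist-2 spider (toFin centre) (toFin-≢ (inner i) (inner i′) λ { refl → i≢i′ refl })
        (λ e → case Adj⇒adjᴷ {inner i} {inner i′} e of λ ())
        (Adj-parent (inner i) λ ()) (Adj-child (inner i′) λ ())

    Dist-extra-inner : ∀ t i → Distᴷ (extra t) (inner i) 2
    Dist-extra-inner t i =
      Dist-PendantAt spider (extra-pendant t) (toFin-≢ (extra t) (inner i) λ ()) (Dist-sym spider (Dist-inner-centre i))

    Dist-outer-parent : ∀ j → Distᴷ (outer j) (inner (f j)) 1
    Dist-outer-parent j = Adj⇒Dist-1 spider (PendantAt.adjacent (outer-pendant j))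

    Dist-outer-inner : ∀ {j i} → f j ≢ i → Distᴷ (outer j) (inner i) 3
    Dist-outer-inner {j} {i} fj≢i =
      Dist-PendantAt spider (outer-pendant j) (toFin-≢ (outer j) (inner i) λ ()) (Dist-inner-inner fj≢i)

    Dist-outer-extra : ∀ j t → Distᴷ (outer j) (extra t) 3
    Dist-outer-extra j t =
      Dist-PendantAt spider (outer-pendant j) (toFin-≢ (outer j) (extra t) λ ())
        (Dist-sym spider (Dist-extra-inner t (f j)))

    Dist-outer-outer-4 : ∀ {j j′} → f j ≢ f j′ → Distᴷ (outer j) (outer j′) 4
    Dist-outer-outer-4 {j} {j′} fj≢fj′ =
      Dist-PendantAt spider (outer-pendant j) (toFin-≢ (outer j) (outer j′) λ { refl → fj≢fj′ refl })
        (Dist-sym spider (Dist-outer-inner λ eq → fj≢fj′ (sym eq)))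

    spider-cherry : ∀ {j j′} → j ≢ j′ → f j ≡ f j′ → Cherry spider
    spider-cherry {j} {j′} j≢j′ fj≡fj′ =
      toFin (outer j) , toFin (outer j′) , toFin (inner (f j)) ,
      toFin-≢ (outer j) (outer j′) (λ { refl → j≢j′ refl }) , outer-pendant j ,
      subst (λ i → PendantAt spider (toFin (outer j′)) (toFin (inner i))) (sym fj≡fj′) (outer-pendant j′)

  -- For a permutation the leaves are the outer vertices and the extra vertex,
  -- and their neighbours are pairwise distinct.
  spider-cherry-free : (σ : Permutation′ m) {i₀ i₁ : Fin m} → i₀ ≢ i₁ → ((t t′ : Fin r) → t ≡ t′) →
    ¬ Cherry (spider (σ ⟨$⟩ʳ_))
  spider-cherry-free σ {i₀} {i₁} i₀≢i₁ extra-unique (l₁ , l₂ , v , l₁≢l₂ , p₁ , p₂) =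
    l₁≢l₂ (fromFin-injective (same-kind (fromFin l₁) (fromFin l₂) (ofKind l₁ p₁) (ofKind l₂ p₂)))
    where
    f = σ ⟨$⟩ʳ_
    T = spider f
    ofKind : ∀ x → PendantAt T x v → PendantAt T (toFin (fromFin x)) v
    ofKind x = subst (λ y → PendantAt T y v) (sym (toFin-fromFin x))
    centre-not-pendant : ¬ PendantAt T (toFin centre) v
    centre-not-pendant = two-neighbours⇒¬PendantAt T (Adj-child f (inner i₀) λ ()) (Adj-child f (inner i₁) λ ())
      (toFin-≢ (inner i₀) (inner i₁) λ { refl → i₀≢i₁ refl })
    inner-not-pendant : ∀ i → ¬ PendantAt T (toFin (inner i)) v
    inner-not-pendant i = two-neighbours⇒¬PendantAt T (Adj-parent f (inner i) λ ())
      (subst (λ i′ → Adjᴷ f (inner i′) (outer (σ ⟨$⟩ˡ i))) (Perm.inverseʳ σ)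
             (Adj-child f (outer (σ ⟨$⟩ˡ i)) λ ()))
      (toFin-≢ centre (outer (σ ⟨$⟩ˡ i)) λ ())
    same-kind : ∀ k k′ → PendantAt T (toFin k) v → PendantAt T (toFin k′) v → k ≡ k′
    same-kind centre    _          p _  = ⊥-elim (centre-not-pendant p)
    same-kind (inner i) _          p _  = ⊥-elim (inner-not-pendant i p)
    same-kind _         centre     _ p′ = ⊥-elim (centre-not-pendant p′)
    same-kind _         (inner i′) _ p′ = ⊥-elim (inner-not-pendant i′ p′)
    same-kind (outer j) (outer j′) p p′ = cong outer (⟨$⟩ʳ-injective σ (inner-injective (toFin-injective
      (trans (PendantAt-functional T (outer-pendant f j) p) (PendantAt-functional T p′ (outer-pendant f j′))))))
    same-kind (outer j) (extra t′) p p′ with () ← toFin-injective {inner (f j)} {centre}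
      (trans (PendantAt-functional T (outer-pendant f j) p) (PendantAt-functional T p′ (extra-pendant f t′)))
    same-kind (extra t) (outer j′) p p′ with () ← toFin-injective {centre} {inner (f j′)}
      (trans (PendantAt-functional T (extra-pendant f t) p) (PendantAt-functional T p′ (outer-pendant f j′)))
    same-kind (extra t) (extra t′) _ _ = cong extra (extra-unique t t′)

-- The adversary answers as if the hidden tree were spider f for an f it has
-- not fixed yet.  It keeps a permutation σ and the promises made so far:
-- f b = σ b for every committed (non-free) b, f b ≢ a for excluded b a,
-- and f b ≢ f b′ for separated b b′.
module Adversary (m r : ℕ) (extra-unique : (t t′ : Fin r) → t ≡ t′) where

  open Spiders m r

  weight : (separated excluded : Fin m → Fin m → Bool) → Permutation′ m → Fin m → Fin m → ℕ
  weight separated excluded σ x y =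
    𝟙 (separated x y) + 𝟙 (separated y x) + 2 * 𝟙 (excluded x (σ ⟨$⟩ʳ y))

  weight-permute : ∀ u sep ex σ (τ : Permutation′ m) → (∀ y → u (τ ⟨$⟩ʳ y) ≡ u y) →
    pairWeight u (weight sep ex (τ ∘ₚ σ)) ≡ pairWeight u (weight sep ex σ)
  weight-permute u sep ex σ τ u∘τ≡u = begin
    pairWeight u (weight sep ex (τ ∘ₚ σ))
      ≡⟨ pairWeight-+ u separation (λ x y → exclusion x (τ ⟨$⟩ʳ y)) ⟩
    pairWeight u separation + pairWeight u (λ x y → exclusion x (τ ⟨$⟩ʳ y))
      ≡⟨ cong (pairWeight u separation +_) (pairWeight-permuteʳ u τ u∘τ≡u exclusion) ⟩
    pairWeight u separation + pairWeight u exclusion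
      ≡⟨ pairWeight-+ u separation exclusion ⟨
    pairWeight u (weight sep ex σ) ∎
    where
    open ≡-Reasoning
    separation exclusion : Fin m → Fin m → ℕ
    separation x y = 𝟙 (sep x y) + 𝟙 (sep y x)
    exclusion x y = 2 * 𝟙 (ex x (σ ⟨$⟩ʳ y))

  record State : Set where
    field
      σ                : Permutation′ m
      free             : Fin m → Bool
      excluded         : Fin m → Fin m → Bool
      separated        : Fin m → Fin m → Bool
      σ-allowed        : ∀ b → excluded b (σ ⟨$⟩ʳ b) ≡ false
      separated-irrefl : ∀ b → separated b b ≡ false

    size : ℕ
    size = count free

    potential : ℕ
    potential = pairWeight free (weight separated excluded σ)

  open State

  record Respects (S : State) (f : Fin m → Fin m) : Set where
    field
      committed : ∀ b → free S b ≡ false → f b ≡ σ S ⟨$⟩ʳ b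
      avoids    : ∀ b a → excluded S b a ≡ true → f b ≢ a
      separates : ∀ b b′ → separated S b b′ ≡ true → f b ≢ f b′

  σ-respects : ∀ S → Respects S (σ S ⟨$⟩ʳ_)
  σ-respects S = record
    { committed = λ _ _ → refl
    ; avoids    = λ b a ex σb≡a → clash ex (subst (λ a′ → excluded S b a′ ≡ false) σb≡a (σ-allowed S b))
    ; separates = λ b b′ sep σb≡σb′ → clash sep
        (subst (λ b″ → separated S b b″ ≡ false) (⟨$⟩ʳ-injective (σ S) σb≡σb′) (separated-irrefl S b))
    }

  data Progress (S S′ : State) : Set where
    unchanged : size S′ ≡ size S → potential S′ ≤ potential S + 2 → Progress S S′
    commits   : size S ≡ suc (size S′) → potential S′ + 2 * size S′ ≤ potential S → Progress S S′

  Bound : State → ℕ → Set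
  Bound S k = size S * size S ≤ 2 * k + potential S + size S

  Bound-step : ∀ {S S′ k} → Progress S S′ → Bound S′ k → Bound S (suc k)
  Bound-step {S} {S′} {k} (unchanged s′≡s p′≤) bound = begin
    size S * size S                          ≡⟨ cong₂ _*_ (sym s′≡s) (sym s′≡s) ⟩
    size S′ * size S′                        ≤⟨ bound ⟩
    2 * k + potential S′ + size S′           ≤⟨ +-mono-≤ (+-monoʳ-≤ _ p′≤) (≤-reflexive s′≡s) ⟩
    2 * k + (potential S + 2) + size S       ≡⟨ rearrange k (potential S) (size S) ⟩
    2 * suc k + potential S + size S         ∎
    where
    open ≤-Reasoning
    rearrange : ∀ k p s → 2 * k + (p + 2) + s ≡ 2 * suc k + p + s
    rearrange = solve-∀
  Bound-step {S} {S′} {k} (commits s≡1+s′ p′+2s′≤) bound = begin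
    size S * size S                          ≡⟨ cong₂ _*_ s≡1+s′ s≡1+s′ ⟩
    suc s′ * suc s′                          ≡⟨ expand s′ ⟩
    s′ * s′ + (2 * s′ + 1)                   ≤⟨ +-monoˡ-≤ _ bound ⟩
    2 * k + potential S′ + s′ + (2 * s′ + 1) ≡⟨ regroup k (potential S′) s′ ⟩
    2 * k + (potential S′ + 2 * s′) + suc s′ ≤⟨ +-monoˡ-≤ (suc s′) (+-monoʳ-≤ (2 * k) p′+2s′≤) ⟩
    2 * k + potential S + suc s′             ≤⟨ +-monoˡ-≤ _ (+-monoˡ-≤ _ (*-monoʳ-≤ 2 (n≤1+n k))) ⟩
    2 * suc k + potential S + suc s′         ≡⟨ cong (2 * suc k + potential S +_) (sym s≡1+s′) ⟩
    2 * suc k + potential S + size S         ∎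
    where
    open ≤-Reasoning
    s′ = size S′
    expand : ∀ s → suc s * suc s ≡ s * s + (2 * s + 1)
    expand = solve-∀
    regroup : ∀ k p s → 2 * k + p + s + (2 * s + 1) ≡ 2 * k + (p + 2 * s) + suc s
    regroup = solve-∀

  record Reply (S : State) (k k′ : Kind) : Set where
    field
      distance : ℕ
      next     : State
      weaker   : ∀ {f} → Respects next f → Respects S f
      correct  : ∀ {f} → Respects next f → Distᴷ f k k′ distance
      progress : Progress S next

  fixedReply : ∀ S {k k′} d → (∀ f → Distᴷ f k k′ d) → Reply S k k′
  fixedReply S d dist = record
    { distance = d ; next = S ; weaker = λ resp → resp ; correct = λ {f} _ → dist f
    ; progress = unchanged refl (m≤m+n _ 2) }

  Reply-sym : ∀ {S k k′} → Reply S k k′ → Reply S k′ k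
  Reply-sym rep = record { Reply rep ; correct = λ {f} → Dist-sym (spider f) ∘ Reply.correct rep }

  module _ (S : State) where

    separateReply : ∀ {j j′} → j ≢ j′ → Reply S (outer j) (outer j′)
    separateReply {j} {j′} j≢j′ = record
      { distance = 4
      ; next     = S′
      ; weaker   = λ resp → record
          { Respects resp
          ; separates = λ b b′ → Respects.separates resp b b′ ∘ addPair-old (separated S) j j′ }
      ; correct  = λ {f} resp →
          Dist-outer-outer-4 f (Respects.separates resp j j′ (addPair-new (separated S) j j′))
      ; progress = unchanged refl (begin
          potential S′                ≤⟨ pairWeight-bump (free S) 1 j′ j weight≤ ⟩
          pairWeight (free S) w₁ + 1  ≤⟨ +-monoˡ-≤ 1 (pairWeight-bump (free S) 1 j j′ λ _ _ → ≤-refl) ⟩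
          potential S + 1 + 1         ≡⟨ +-assoc (potential S) 1 1 ⟩
          potential S + 2             ∎)
      }
      where
      open ≤-Reasoning
      S′ : State
      S′ = record S
        { separated        = addPair (separated S) j j′
        ; separated-irrefl = λ b →
            addPair-false (separated S) j j′ (separated-irrefl S b) λ { refl refl → j≢j′ refl }
        }
      w₁ : Fin m → Fin m → ℕ
      w₁ x y = weight (separated S) (excluded S) (σ S) x y + 1 * (δ j x * δ j′ y)
      weight≤ : ∀ x y → weight (separated S′) (excluded S) (σ S) x y ≤ w₁ x y + 1 * (δ j′ x * δ j y)
      weight≤ x y =
        ≤-trans (+-monoˡ-≤ _ (+-mono-≤ (𝟙-addPair (separated S) j j′ x y) (𝟙-addPair (separated S) j j′ y x)))
                (≤-reflexive (rearrange a b c (δ j x) (δ j′ y) (δ j y) (δ j′ x)))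
        where
        a = 𝟙 (separated S x y)
        b = 𝟙 (separated S y x)
        c = 2 * 𝟙 (excluded S x (σ S ⟨$⟩ʳ y))
        rearrange : ∀ a b c p q p′ q′ →
          a + p * q + (b + p′ * q′) + c ≡ a + b + c + 1 * (p * q) + 1 * (q′ * p′)
        rearrange = solve-∀

    committedReply : ∀ {j} i → free S j ≡ false → Reply S (outer j) (inner i)
    committedReply {j} i j-committed with σ S ⟨$⟩ʳ j ≟ i
    ... | yes σj≡i = record
      { distance = 1 ; next = S ; weaker = λ resp → resp ; progress = unchanged refl (m≤m+n _ 2)
      ; correct  = λ {f} resp → subst (λ a → Distᴷ f (outer j) (inner a) 1)
          (trans (Respects.committed resp j j-committed) σj≡i) (Dist-outer-parent f j) }
    ... | no σj≢i = record
      { distance = 3 ; next = S ; weaker = λ resp → resp ; progress = unchanged refl (m≤m+n _ 2)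
      ; correct  = λ {f} resp → Dist-outer-inner f λ fj≡i →
          σj≢i (trans (sym (Respects.committed resp j j-committed)) fj≡i) }

    -- Promising f j ≢ i raises only the weight of the pair (j, π⁻¹ i), by 2.
    excludeReply : ∀ (π : Permutation′ m) j i →
      (∀ b → free S b ≡ false → π ⟨$⟩ʳ b ≡ σ S ⟨$⟩ʳ b) →
      (allowed : ∀ b → addPair (excluded S) j i b (π ⟨$⟩ʳ b) ≡ false) →
      pairWeight (free S) (weight (separated S) (excluded S) π) ≡ potential S →
      Reply S (outer j) (inner i)
    excludeReply π j i agree allowed same-potential = record
      { distance = 3
      ; next     = S′
      ; weaker   = λ resp → record
          { committed = λ b b-committed → trans (Respects.committed resp b b-committed) (agree b b-committed)
          ; avoids    = λ b a ex → Respects.avoids resp b a (addPair-old (excluded S) j i ex)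
          ; separates = Respects.separates resp }
      ; correct  = λ {f} resp → Dist-outer-inner f (Respects.avoids resp j i (addPair-new (excluded S) j i))
      ; progress = unchanged refl (begin
          potential S′
            ≤⟨ pairWeight-bump (free S) 2 j (π ⟨$⟩ˡ i) weight≤ ⟩
          pairWeight (free S) (weight (separated S) (excluded S) π) + 2
            ≡⟨ cong (_+ 2) same-potential ⟩
          potential S + 2 ∎)
      }
      where
      open ≤-Reasoning
      S′ : State
      S′ = record S { σ = π ; excluded = addPair (excluded S) j i ; σ-allowed = allowed }
      weight≤ : ∀ x y → weight (separated S) (excluded S′) π x y ≤
                        weight (separated S) (excluded S) π x y + 2 * (δ j x * δ (π ⟨$⟩ˡ i) y)
      weight≤ x y = ≤-trans (+-monoʳ-≤ (a + b) (*-monoʳ-≤ 2 (𝟙-addPair (excluded S) j i x (π ⟨$⟩ʳ y))))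
        (≤-reflexive (trans (cong (λ e → a + b + 2 * (c + δ j x * e)) (δ-permute π i y)) (distribute a b c _)))
        where
        a = 𝟙 (separated S x y)
        b = 𝟙 (separated S y x)
        c = 𝟙 (excluded S x (π ⟨$⟩ʳ y))
        distribute : ∀ a b c p → a + b + 2 * (c + p) ≡ a + b + 2 * c + 2 * p
        distribute = solve-∀

    Partner : Fin m → Fin m → Fin m → Set
    Partner j i j′ =
      free S j′ ≡ true × j′ ≢ j × excluded S j′ i ≡ false × excluded S j (σ S ⟨$⟩ʳ j′) ≡ false

    partner? : ∀ j i → Dec (∃ (Partner j i))
    partner? j i = any? λ j′ →
      (free S j′ Bool.≟ true) ×-dec ¬? (j′ ≟ j) ×-dec
      (excluded S j′ i Bool.≟ false) ×-dec (excluded S j (σ S ⟨$⟩ʳ j′) Bool.≟ false)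

    -- To promise f j ≢ i although σ j = i, exchange the values of σ at j and
    -- at a partner j′.
    swapReply : ∀ {j i} → free S j ≡ true → σ S ⟨$⟩ʳ j ≡ i → ∃ (Partner j i) →
      Reply S (outer j) (inner i)
    swapReply {j} {i} j-free σj≡i (j′ , j′-free , j′≢j , j′i-allowed , jσj′-allowed) =
      excludeReply (τ ∘ₚ σ S) j i agree allowed
        (weight-permute (free S) (separated S) (excluded S) (σ S) τ free∘τ)
      where
      τ = Perm.transpose j j′
      committed≢ : ∀ {b b′} → free S b′ ≡ true → free S b ≡ false → b ≢ b′
      committed≢ b′-free b-committed refl = clash b′-free b-committed
      agree : ∀ b → free S b ≡ false → σ S ⟨$⟩ʳ (τ ⟨$⟩ʳ b) ≡ σ S ⟨$⟩ʳ b
      agree b b-committed = cong (σ S ⟨$⟩ʳ_)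
        (transpose-other j j′ (committed≢ j-free b-committed) (committed≢ j′-free b-committed))
      σj′≢i : σ S ⟨$⟩ʳ j′ ≢ i
      σj′≢i σj′≡i = j′≢j (⟨$⟩ʳ-injective (σ S) (trans σj′≡i (sym σj≡i)))
      allowed′ : ∀ b → Dec (b ≡ j) → Dec (b ≡ j′) →
        addPair (excluded S) j i b (σ S ⟨$⟩ʳ (τ ⟨$⟩ʳ b)) ≡ false
      allowed′ b (yes refl) _ rewrite transpose-matchˡ j j′ =
        addPair-false (excluded S) j i jσj′-allowed λ _ → σj′≢i
      allowed′ b (no b≢j) (yes refl) rewrite transpose-matchʳ j j′ | σj≡i =
        addPair-false (excluded S) j i j′i-allowed λ j′≡j _ → j′≢j j′≡j
      allowed′ b (no b≢j) (no b≢j′) rewrite transpose-other j j′ b≢j b≢j′ =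
        addPair-false (excluded S) j i (σ-allowed S b) λ b≡j _ → b≢j b≡j
      allowed : ∀ b → addPair (excluded S) j i b (σ S ⟨$⟩ʳ (τ ⟨$⟩ʳ b)) ≡ false
      allowed b = allowed′ b (b ≟ j) (b ≟ j′)
      free∘τ′ : ∀ y → Dec (y ≡ j) → Dec (y ≡ j′) → free S (τ ⟨$⟩ʳ y) ≡ free S y
      free∘τ′ y (yes refl) _       rewrite transpose-matchˡ j j′ = trans j′-free (sym j-free)
      free∘τ′ y (no _) (yes refl)  rewrite transpose-matchʳ j j′ = trans j-free (sym j′-free)
      free∘τ′ y (no y≢j) (no y≢j′) rewrite transpose-other j j′ y≢j y≢j′ = refl
      free∘τ : ∀ y → free S (τ ⟨$⟩ʳ y) ≡ free S y
      free∘τ y = free∘τ′ y (y ≟ j) (y ≟ j′)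

    -- Without a partner every other free y has excluded y i or excluded j (σ y),
    -- which puts weight 2 on the pair {j, y}: committing j pays for the query.
    commitReply : ∀ {j i} → free S j ≡ true → σ S ⟨$⟩ʳ j ≡ i → ¬ ∃ (Partner j i) →
      Reply S (outer j) (inner i)
    commitReply {j} {i} j-free σj≡i no-partner = record
      { distance = 1
      ; next     = S′
      ; weaker   = λ resp → record
          { Respects resp
          ; committed = λ b b-committed → Respects.committed resp b (remove-false (free S) j b-committed) }
      ; correct  = λ {f} resp → subst (λ a → Distᴷ f (outer j) (inner a) 1)
          (trans (Respects.committed resp j (remove-self (free S) j)) σj≡i) (Dist-outer-parent f j)
      ; progress = commits (count-remove (free S) j-free) (begin
          potential S′ + 2 * size S′               ≤⟨ +-monoʳ-≤ _ (rowWeight-lower u′ 2 symmetric j two) ⟩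
          potential S′ + rowWeight u′ symmetric j  ≤⟨ pairWeight-remove (free S) j-free w ⟩
          potential S                              ∎)
      }
      where
      open ≤-Reasoning
      u′ = remove (free S) j
      w = weight (separated S) (excluded S) (σ S)
      symmetric : Fin m → Fin m → ℕ
      symmetric x y = w x y + w y x
      S′ : State
      S′ = record S { free = u′ }
      excluded⇒2≤ : ∀ {x y} → excluded S x (σ S ⟨$⟩ʳ y) ≡ true → 2 ≤ w x y
      excluded⇒2≤ {x} {y} ex rewrite ex = m≤n+m 2 (𝟙 (separated S x y) + 𝟙 (separated S y x))
      two : ∀ y → u′ y ≡ true → 2 ≤ symmetric j y
      two y y∈u′ = by-cases (excluded S y i) (excluded S j (σ S ⟨$⟩ʳ y)) refl refl
        where
        by-cases : ∀ a b → excluded S y i ≡ a → excluded S j (σ S ⟨$⟩ʳ y) ≡ b → 2 ≤ symmetric j y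
        by-cases false false yi jσy = ⊥-elim (no-partner (y , proj₁ (remove-true (free S) j y∈u′) ,
                                                             proj₂ (remove-true (free S) j y∈u′) , yi , jσy))
        by-cases _     true  _  jσy = ≤-trans (excluded⇒2≤ jσy) (m≤m+n (w j y) (w y j))
        by-cases true  false yi _   =
          ≤-trans (excluded⇒2≤ (subst (λ a → excluded S y a ≡ true) (sym σj≡i) yi)) (m≤n+m (w y j) (w j y))

    outerInnerReply : ∀ j i → Reply S (outer j) (inner i)
    outerInnerReply j i with free S j in j-free | σ S ⟨$⟩ʳ j ≟ i
    ... | false | _        = committedReply i j-free
    ... | true  | no σj≢i  = excludeReply (σ S) j i (λ _ _ → refl)
      (λ b → addPair-false (excluded S) j i (σ-allowed S b) λ { refl σj≡i → σj≢i σj≡i }) refl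
    ... | true  | yes σj≡i with partner? j i
    ...   | yes partner = swapReply j-free σj≡i partner
    ...   | no none     = commitReply j-free σj≡i none

    reply : ∀ k k′ → k ≢ k′ → Reply S k k′
    reply centre    centre     k≢k′ = ⊥-elim (k≢k′ refl)
    reply centre    (inner i)  _    = Reply-sym (fixedReply S 1 λ f → Dist-inner-centre f i)
    reply centre    (outer j)  _    = Reply-sym (fixedReply S 2 λ f → Dist-outer-centre f j)
    reply centre    (extra t)  _    = Reply-sym (fixedReply S 1 λ f → Dist-extra-centre f t)
    reply (inner i) centre     _    = fixedReply S 1 λ f → Dist-inner-centre f i
    reply (inner i) (inner i′) k≢k′ = fixedReply S 2 λ f → Dist-inner-inner f λ { refl → k≢k′ refl }
    reply (inner i) (outer j)  _    = Reply-sym (outerInnerReply j i)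
    reply (inner i) (extra t)  _    = Reply-sym (fixedReply S 2 λ f → Dist-extra-inner f t i)
    reply (outer j) centre     _    = fixedReply S 2 λ f → Dist-outer-centre f j
    reply (outer j) (inner i)  _    = outerInnerReply j i
    reply (outer j) (outer j′) k≢k′ = separateReply λ { refl → k≢k′ refl }
    reply (outer j) (extra t)  _    = fixedReply S 3 λ f → Dist-outer-extra f j t
    reply (extra t) centre     _    = fixedReply S 1 λ f → Dist-extra-centre f t
    reply (extra t) (inner i)  _    = fixedReply S 2 λ f → Dist-extra-inner f t i
    reply (extra t) (outer j)  _    = Reply-sym (fixedReply S 3 λ f → Dist-outer-extra f j t)
    reply (extra t) (extra t′) k≢k′ = ⊥-elim (k≢k′ (cong extra (extra-unique t t′)))

  redirect : Permutation′ m → Fin m → Fin m → Fin m → Fin m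
  redirect σ x a b with b ≟ x
  ... | yes _ = a
  ... | no _  = σ ⟨$⟩ʳ b

  redirect-self : ∀ σ x a → redirect σ x a x ≡ a
  redirect-self σ x a with x ≟ x
  ... | yes _   = refl
  ... | no x≢x  = ⊥-elim (x≢x refl)

  redirect-other : ∀ σ x a {b} → b ≢ x → redirect σ x a b ≡ σ ⟨$⟩ʳ b
  redirect-other σ x a {b} b≢x with b ≟ x
  ... | yes b≡x = ⊥-elim (b≢x b≡x)
  ... | no _    = refl

  redirect-respects : ∀ S {x y} → free S x ≡ true → separated S x y ≡ false → separated S y x ≡ false →
    excluded S x (σ S ⟨$⟩ʳ y) ≡ false → Respects S (redirect (σ S) x (σ S ⟨$⟩ʳ y))
  redirect-respects S {x} {y} x-free xy-apart yx-apart xσy-allowed = record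
    { committed = λ b b-committed → redirect-other (σ S) x _ λ { refl → clash x-free b-committed }
    ; avoids    = λ b a → avoids b a (b ≟ x)
    ; separates = λ b b′ → separates b b′ (b ≟ x) (b′ ≟ x)
    }
    where
    f = redirect (σ S) x (σ S ⟨$⟩ʳ y)
    σ-resp = σ-respects S
    fx≡σy = redirect-self (σ S) x (σ S ⟨$⟩ʳ y)
    fb≡σb = redirect-other (σ S) x (σ S ⟨$⟩ʳ y)
    avoids : ∀ b a → Dec (b ≡ x) → excluded S b a ≡ true → f b ≢ a
    avoids b a (yes refl) ex fb≡a =
      clash ex (subst (λ a′ → excluded S b a′ ≡ false) (trans (sym fx≡σy) fb≡a) xσy-allowed)
    avoids b a (no b≢x)   ex fb≡a = Respects.avoids σ-resp b a ex (trans (sym (fb≡σb b≢x)) fb≡a)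
    separates : ∀ b b′ → Dec (b ≡ x) → Dec (b′ ≡ x) → separated S b b′ ≡ true → f b ≢ f b′
    separates b b′ (yes refl) (yes refl) sep _ = clash sep (separated-irrefl S b)
    separates b b′ (yes refl) (no b′≢x)  sep eq = clash sep (subst (λ c → separated S b c ≡ false)
      (⟨$⟩ʳ-injective (σ S) (trans (sym fx≡σy) (trans eq (fb≡σb b′≢x)))) xy-apart)
    separates b b′ (no b≢x)  (yes refl) sep eq = clash sep (subst (λ c → separated S c b′ ≡ false)
      (sym (⟨$⟩ʳ-injective (σ S) (trans (sym (fb≡σb b≢x)) (trans eq fx≡σy)))) yx-apart)
    separates b b′ (no b≢x)  (no b′≢x)  sep eq =
      Respects.separates σ-resp b b′ sep (trans (sym (fb≡σb b≢x)) (trans eq (fb≡σb b′≢x)))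

  Determined⇒Bound : ∀ S H → (∀ f → Respects S f → Consistent (spider f) H) → Determined H → Bound S 0
  Determined⇒Bound S H consistent determined =
    pairWeight-lower (free S) (weight (separated S) (excluded S) (σ S)) positive
    where
    positive : ∀ x y → free S x ≡ true → free S y ≡ true → x ≢ y →
      1 ≤ weight (separated S) (excluded S) (σ S) x y
    positive x y x-free _ x≢y =
      by-cases (separated S x y) (separated S y x) (excluded S x (σ S ⟨$⟩ʳ y)) refl refl refl
      where
      by-cases : ∀ a b c → separated S x y ≡ a → separated S y x ≡ b → excluded S x (σ S ⟨$⟩ʳ y) ≡ c →
        1 ≤ weight (separated S) (excluded S) (σ S) x y
      by-cases true  _     _     xy _  _   rewrite xy = s≤s z≤n
      by-cases false true  _     xy yx _   rewrite xy | yx = s≤s z≤n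
      by-cases false false true  xy yx xσy rewrite xy | yx | xσy = s≤s z≤n
      by-cases false false false xy yx xσy = ⊥-elim (spider-cherry-free (σ S) σx≢σy extra-unique
        (Cherry-transport (spider g) (spider f) g≅f (spider-cherry f x≢y fx≡fy)))
        where
        g = σ S ⟨$⟩ʳ_
        f = redirect (σ S) x (σ S ⟨$⟩ʳ y)
        σx≢σy : σ S ⟨$⟩ʳ x ≢ σ S ⟨$⟩ʳ y
        σx≢σy = x≢y ∘ ⟨$⟩ʳ-injective (σ S)
        g≅f : Isomorphic (spider g) (spider f)
        g≅f = determined (spider g) (spider f) (consistent g (σ-respects S))
                         (consistent f (redirect-respects S x-free xy yx xσy))
        fx≡fy : f x ≡ f y
        fx≡fy = trans (redirect-self (σ S) x _) (sym (redirect-other (σ S) x _ (≢-sym x≢y)))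

  adversary-bound : (A : Alg N) (S : State) (H : List (Answer N)) (k : ℕ) →
    (∀ f → Respects S f → Consistent (spider f) H) →
    (∀ f → Respects S f → Works (spider f) A H k) →
    Bound S k
  adversary-bound done S H k consistent works =
    ≤-trans (Determined⇒Bound S H consistent (works _ (σ-respects S)))
            (+-monoˡ-≤ (size S) (m≤n+m (potential S) (2 * k)))
  adversary-bound (ask x y x≢y next) S H zero    _          works = ⊥-elim (works _ (σ-respects S))
  adversary-bound (ask x y x≢y next) S H (suc k) consistent works =
    Bound-step (Reply.progress rep) (adversary-bound (next d) S′ (ans x y d ∷ H) k consistent′ works′)
    where
    rep = reply S (fromFin x) (fromFin y) λ eq → x≢y (fromFin-injective eq)
    d   = Reply.distance rep
    S′  = Reply.next rep
    dist : ∀ f → Respects S′ f → Dist (spider f) x y d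
    dist f resp =
      subst₂ (λ a b → Dist (spider f) a b d) (toFin-fromFin x) (toFin-fromFin y) (Reply.correct rep resp)
    consistent′ : ∀ f → Respects S′ f → Consistent (spider f) (ans x y d ∷ H)
    consistent′ f resp = dist f resp ∷ consistent f (Reply.weaker rep resp)
    works′ : ∀ f → Respects S′ f → Works (spider f) (next d) (ans x y d ∷ H) k
    works′ f resp = works f (Reply.weaker rep resp) d (dist f resp)

  initial : State
  initial = record
    { σ = Perm.id ; free = λ _ → true ; excluded = λ _ _ → false ; separated = λ _ _ → false
    ; σ-allowed = λ _ → refl ; separated-irrefl = λ _ → refl }

  Solves⇒m*m≤2k+m : ∀ {k} → Solves N k → m * m ≤ 2 * k + m
  Solves⇒m*m≤2k+m {k} (A , works) = subst₂ _≤_ (cong₂ _*_ (∑-𝟙 {m}) (∑-𝟙 {m}))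
    (cong₂ _+_ (trans (cong (2 * k +_) no-weight) (+-identityʳ (2 * k))) (∑-𝟙 {m}))
    (adversary-bound A initial [] k (λ _ _ → []) (λ f _ → works (spider f)))
    where
    no-weight : potential initial ≡ 0
    no-weight = trans (sum-cong-≗ {m} λ _ → trans (+-identityʳ _) (sum-replicate-zero m)) (sum-replicate-zero m)

halve : ∀ n → ∃ λ m → ∃ λ r → r ≤ 1 × n ≡ m + (m + r)
halve zero = 0 , 0 , z≤n , refl
halve (suc n) with halve n
... | m , zero    , _         , refl = m , 1 , s≤s z≤n , even+1 m
  where
  even+1 : ∀ m → suc (m + (m + 0)) ≡ m + (m + 1)
  even+1 = solve-∀
... | m , suc zero , _        , refl = suc m , 0 , z≤n , odd+1 m
  where
  odd+1 : ∀ m → suc (m + (m + 1)) ≡ suc m + (suc m + 0)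
  odd+1 = solve-∀
... | m , suc (suc _) , s≤s () , _

Fin-subsingleton : ∀ {r} → r ≤ 1 → (t t′ : Fin r) → t ≡ t′
Fin-subsingleton {suc zero} _        zero zero = refl
Fin-subsingleton {suc (suc _)} (s≤s ()) _ _

spider-size-bound : ∀ m r k → r ≤ 1 → m * m ≤ 2 * k + m →
  suc (m + (m + r)) * suc (m + (m + r)) ≤ 8 * k + 12 * suc (m + (m + r))
spider-size-bound m r k r≤1 m*m≤ = begin
  n * n                                  ≤⟨ *-mono-≤ n≤ n≤ ⟩
  suc (m + (m + 1)) * suc (m + (m + 1))  ≡⟨ square m ⟩
  4 * (m * m) + (8 * m + 4)              ≤⟨ +-monoˡ-≤ (8 * m + 4) (*-monoʳ-≤ 4 m*m≤) ⟩
  4 * (2 * k + m) + (8 * m + 4)          ≤⟨ m≤m+n _ 8 ⟩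
  4 * (2 * k + m) + (8 * m + 4) + 8      ≡⟨ tidy k m ⟩
  8 * k + 12 * suc m                     ≤⟨ +-monoʳ-≤ (8 * k) (*-monoʳ-≤ 12 (s≤s (m≤m+n m (m + r)))) ⟩
  8 * k + 12 * n                         ∎
  where
  open ≤-Reasoning
  n = suc (m + (m + r))
  n≤ : n ≤ suc (m + (m + 1))
  n≤ = s≤s (+-monoʳ-≤ m (+-monoʳ-≤ m r≤1))
  square : ∀ m → suc (m + (m + 1)) * suc (m + (m + 1)) ≡ 4 * (m * m) + (8 * m + 4)
  square = solve-∀
  tidy : ∀ k m → 4 * (2 * k + m) + (8 * m + 4) + 8 ≡ 8 * k + 12 * suc m
  tidy = solve-∀

Solves⇒n*n≤8k+12n : ∀ n k → Solves n k → n * n ≤ 8 * k + 12 * n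
Solves⇒n*n≤8k+12n zero    _ _ = z≤n
Solves⇒n*n≤8k+12n (suc n) k solves with halve n
... | m , r , r≤1 , refl =
  spider-size-bound m r k r≤1 (Adversary.Solves⇒m*m≤2k+m m r (Fin-subsingleton r≤1) solves)

solvable-4k≤n*n+12n : ∀ n → ∃ λ k → Solves n k × 4 * k ≤ n * n + 12 * n
solvable-4k≤n*n+12n zero    = 0 , (done , λ _ _ _ _ _ → Perm.id , λ ()) , z≤n
solvable-4k≤n*n+12n (suc n) = n + N * N / 4 , (strategy , Works-strategy) , (begin
  4 * (n + N * N / 4)      ≡⟨ *-distribˡ-+ 4 n (N * N / 4) ⟩
  4 * n + 4 * (N * N / 4)  ≤⟨ +-mono-≤ (*-mono-≤ (m≤m+n 4 8) (n≤1+n n)) 4⌊N²/4⌋≤N² ⟩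
  12 * N + N * N           ≡⟨ +-comm (12 * N) (N * N) ⟩
  N * N + 12 * N           ∎)
  where
  open ≤-Reasoning
  open ParityStrategy n
  N = suc n
  4⌊N²/4⌋≤N² : 4 * (N * N / 4) ≤ N * N
  4⌊N²/4⌋≤N² = ≤-trans (≤-reflexive (*-comm 4 (N * N / 4))) (m/n*n≤m (N * N) 4)

proposition1p5 : ∃ λ (C : ℕ) → (n : ℕ) →
    ((k : ℕ) → Solves n k → n * n ≤ 8 * k + C * n)
    × (∃ λ (k : ℕ) → Solves n k × 4 * k ≤ n * n + C * n)
proposition1p5 = 12 , λ n → Solves⇒n*n≤8k+12n n , solvable-4k≤n*n+12n n
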